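{- Let $f(t)=\sum_{j\ge 1} \frac{f_j}{j!} t^j$ be a formal power series with complex coefficients, $f(0)=0$ and $f'(0)\neq 0$, and let $\phi$ be the umbral operator associated with $f$, i.e. the linear operator on $\mathbb{C}[x]$ defined by $\phi x^n=\phi_n(x)$, where the polynomials $\phi_n$ are given by $e^{xf(t)}=\sum_{n\ge0}\phi_n(x)\frac{t^n}{n!}$. Let $Q=f^{ -1}(D)$ be its delta operator. Then for every nonnegative integer $n$, \[ \phi\, \mathrm{x}^n=\sum_{k=0}^n \mathrm{x}^k\, B_{n,k}\big(f^{(1)}(Q),f^{(2)}(Q),\dots,f^{(n-k+1)}(Q)\big)\,\phi \] as operators on $\mathbb{C}[x]$.
   Context: $D$ denotes differentiation with respect to $x$ on $\mathbb{C}[x]$, and $\mathrm{x}$ denotes the operator of multiplication by $x$. $f^{ -1}$ is the compositional inverse of $f$, and for a formal power series $g$, $g(D)$ (resp. $g(Q)$) is the operator obtained by substituting $D$ (resp. $Q$) into $g$; this is well defined on polynomials since $D$ is locally nilpotent and $Q=f^{ -1}(D)$ has no constant term. $f^{(j)}$ denotes the $j$-th derivative of $f$ (a formal power series), so $f^{(j)}(Q)$ is a shift-invariant operator. $B_{n,k}$ is the partial (exponential) Bell polynomial, defined by $\frac{1}{k!}\big(\sum_{j\ge1} y_j \frac{t^j}{j!}\big)^k=\sum_{n\ge k} B_{n,k}(y_1,\dots,y_{n-k+1})\frac{t^n}{n!}$; its arguments here are commuting operators. -}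

module Defs where

open import Level using (Level)
open import Data.Nat as ℕ using (ℕ; zero; suc; _∸_)
open import Data.Nat.Combinatorics using (_C_)
open import Data.List using (List; []; _∷_; map; upTo; replicate; _++_; foldr)
open import Data.Product using (∃)
open import Relation.Nullary using (¬_)
open import Algebra.Bundles using (CommutativeRing)

-- Generic operations needed to evaluate a (partial) Bell polynomial
-- with arguments in some algebraic structure (here: a ring, or the
-- algebra of linear operators on R[x]).
record BellOps {a} (A : Set a) : Set a where
  field
    zero# one# : A
    _⊕_ _⊗_    : A → A → A

module _ {a} {A : Set a} (O : BellOps A) where
  open BellOps O

  natMul : ℕ → A → A
  natMul zero    x = zero#
  natMul (suc n) x = x ⊕ natMul n x

  sumTo : ℕ → (ℕ → A) → A
  sumTo n g = foldr _⊕_ zero# (map g (upTo (suc n)))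

  -- Partial exponential Bell polynomial B_{n,k}(y₁, y₂, …); y 0 is never used.
  bell : (ℕ → A) → ℕ → ℕ → A
  bell y zero    zero    = one#
  bell y (suc n) zero    = zero#
  bell y zero    (suc k) = zero#
  bell y (suc n) (suc k) =
    sumTo n (λ i → natMul (n C i) (y (suc i) ⊗ bell y (n ∸ i) k))

module WithRing {c ℓ} (R : CommutativeRing c ℓ) where
  open CommutativeRing R renaming (Carrier to K)

  ringOps : BellOps K
  ringOps = record { zero# = 0# ; one# = 1# ; _⊕_ = _+_ ; _⊗_ = _*_ }

  -- K is a field of characteristic zero (standing in for ℂ)
  IsFieldChar0 : Set (c Level.⊔ ℓ)
  IsFieldChar0 =
    (∀ (u : K) → ¬ (u ≈ 0#) → ∃ λ v → u * v ≈ 1#)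
    Data.Product.× (∀ n → ¬ (natMul ringOps (suc n) 1# ≈ 0#))

  -- Formal power series, by exponential coefficients:
  -- a series a stands for Σ_n a n · tⁿ / n!.
  Series : Set c
  Series = ℕ → K

  _≈ˢ_ : Series → Series → Set ℓ
  a ≈ˢ b = ∀ n → a n ≈ b n

  tSeries : Series
  tSeries zero          = 0#
  tSeries (suc zero)    = 1#
  tSeries (suc (suc n)) = 0#

  deriv : ℕ → Series → Series
  deriv j f n = f (n ℕ.+ j)

  -- composition g ∘ h (h 0 ≈ 0), Faà di Bruno:
  --  (g∘h)_n = Σ_{k=0}^n g_k B_{n,k}(h₁,…), since h^k/k! = Σ_n B_{n,k}(h) tⁿ/n!
  compose : Series → Series → Series
  compose g h n = sumTo ringOps n (λ k → g k * bell ringOps h n k)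

  -- Polynomials in K[x] as coefficient lists (constant term first)
  Poly : Set c
  Poly = List K

  coeff : Poly → ℕ → K
  coeff []       _       = 0#
  coeff (a ∷ p)  zero    = a
  coeff (a ∷ p)  (suc i) = coeff p i

  _+ᵖ_ : Poly → Poly → Poly
  []      +ᵖ q       = q
  (a ∷ p) +ᵖ []      = a ∷ p
  (a ∷ p) +ᵖ (b ∷ q) = (a + b) ∷ (p +ᵖ q)

  scaleᵖ : K → Poly → Poly
  scaleᵖ r p = map (r *_) p

  monomial : ℕ → Poly
  monomial m = replicate m 0# ++ (1# ∷ [])

  -- Linear operators on K[x], given by their values on the basis xᵐ
  Op : Set c
  Op = ℕ → Poly

  applyFrom : Op → ℕ → Poly → Poly
  applyFrom T i []      = []
  applyFrom T i (a ∷ p) = scaleᵖ a (T i) +ᵖ applyFrom T (suc i) p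

  apply : Op → Poly → Poly
  apply T = applyFrom T 0

  -- equality of operators (linear maps are determined on a basis)
  _≈ᵒ_ : Op → Op → Set ℓ
  S ≈ᵒ T = ∀ m i → coeff (S m) i ≈ coeff (T m) i

  idOp : Op
  idOp = monomial

  _∘ᵒ_ : Op → Op → Op
  (S ∘ᵒ T) m = apply S (T m)

  _+ᵒ_ : Op → Op → Op
  (S +ᵒ T) m = S m +ᵖ T m

  opOps : BellOps Op
  opOps = record { zero# = λ _ → [] ; one# = idOp ; _⊕_ = _+ᵒ_ ; _⊗_ = _∘ᵒ_ }

  mulX : ℕ → Op
  mulX n m = monomial (m ℕ.+ n)

  -- shift-invariant operator a(D) = Σ_n a_n Dⁿ/n!;
  -- (Dⁿ/n!) xᵐ = C(m,n) x^{m-n}, so coefficient of xⁱ in a(D)xᵐ is C(m,m-i)·a_{m-i}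
  seriesOp : Series → Op
  seriesOp a m = map (λ i → natMul ringOps (m C (m ∸ i)) (a (m ∸ i))) (upTo (suc m))

  -- g(Q) where Q = h(D): g(Q) = Σ_k g_k Q^k/k! = (g ∘ h)(D)
  atQ : Series → Series → Op
  atQ h g = seriesOp (compose g h)

  -- umbral operator: φ xᵐ = φ_m(x) = Σ_k B_{m,k}(f₁,f₂,…) xᵏ,
  -- from e^{x f(t)} = Σ_k xᵏ f(t)ᵏ/k!
  umbral : Series → Op
  umbral f m = map (λ k → bell ringOps f m k) (upTo (suc m))

-- Everything is compared coefficientwise, power series being in exponential form.  The coefficient
-- of xⁱ in φ xᵐ⁺ⁿ is B_{m+n,i}(f), the m-th coefficient of Dⁿ(fⁱ/i!), and fⁱ/i! = (tⁱ/i!) ∘ f.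
-- On the right, a ↦ a(D) is a ring homomorphism, so B_{n,k}(f⁽ʲ⁾(Q)) = B_{n,k}(f⁽ʲ⁾ ∘ h)(D); and
-- A(D) φ xᵐ has coefficients (fʲ/j! · A ∘ f)_m, because (fᑫ/q!)(fʲ/j!) = C(q+j,q) fᑫ⁺ʲ/(q+j)!.
-- Composition with f is a ring homomorphism undoing ∘ h, and multiplying by xᵏ amounts to pairing
-- with Dᵏ(tⁱ/i!), so the k-th summand becomes (B_{n,k}(f′, f″, …) · Dᵏ(tⁱ/i!) ∘ f)_m.  The identity
-- is then Faà di Bruno's formula for Dⁿ((tⁱ/i!) ∘ f), which follows by induction on n from the chain
-- rule and B_{n+1,k+1}(y) = D B_{n,k+1}(y) + y₁ B_{n,k}(y), valid whenever D yⱼ = yⱼ₊₁.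

module Submission where

open import Defs
open import Level using (Level)
open import Data.Nat using (ℕ)
open import Relation.Nullary using (¬_)
open import Algebra.Bundles using (CommutativeRing)

open import Data.Nat as ℕ using (zero; suc; _∸_; _≤_; _<_; s≤s; z<s)
open import Data.Nat.Induction using (<-rec)
import Data.Nat.Properties as ℕ
open import Data.Nat.Combinatorics using (_C_; nCk+nC[k+1]≡[n+1]C[k+1]; k>n⇒nCk≡0; nCn≡1)
open import Data.Fin using (toℕ)
open import Data.Fin.Properties using (toℕ<n; toℕ-inject₁; toℕ-fromℕ)
open import Data.List using ([]; _∷_; map; upTo; applyUpTo; foldr; length)
import Data.List.Properties as List
open import Data.Product using (_,_)
open import Data.Sum using (_⊎_; inj₁; inj₂)
open import Function using (_∘_)
open import Relation.Binary.PropositionalEquality as ≡ using (_≡_)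
open import Relation.Binary.Bundles using (Setoid)
import Relation.Binary.Reasoning.Setoid

module BinomialCoefficients where

  open import Data.Nat using (_+_; _*_; _!)
  open import Data.Nat.Properties using (m+n∸n≡m; m≤n+m; *-cancelʳ-≡; m*n≢0; _!≢0; _!*_!≢0; +-assoc; +-comm)
  open import Data.Nat.Combinatorics using (nCk≡n!/k![n-k]!; k![n∸k]!∣n!)
  open import Data.Nat.DivMod using (_/_; m/n*n≡m)
  open import Data.Nat.Solver using (module +-*-Solver)
  open ≡.≡-Reasoning

  [m+n]Cn*[n!*m!]≡[m+n]! : ∀ m n → ((m + n) C n) * (n ! * m !) ≡ (m + n) !
  [m+n]Cn*[n!*m!]≡[m+n]! m n = begin
    ((m + n) C n) * (n ! * m !)
      ≡⟨ ≡.cong (λ k → ((m + n) C n) * (n ! * k !)) (m+n∸n≡m m n) ⟨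
    ((m + n) C n) * (n ! * (m + n ∸ n) !)
      ≡⟨ ≡.cong (_* (n ! * (m + n ∸ n) !)) (nCk≡n!/k![n-k]! (m≤n+m n m)) ⟩
    ((m + n) ! / (n ! * (m + n ∸ n) !)) * (n ! * (m + n ∸ n) !)
      ≡⟨ m/n*n≡m (k![n∸k]!∣n! (m≤n+m n m)) ⟩
    (m + n) ! ∎
    where instance _ = n !* (m + n ∸ n) !≢0

  [m+n]Cm*[m!*n!]≡[m+n]! : ∀ m n → ((m + n) C m) * (m ! * n !) ≡ (m + n) !
  [m+n]Cm*[m!*n!]≡[m+n]! m n = begin
    ((m + n) C m) * (m ! * n !)   ≡⟨ ≡.cong (λ k → (k C m) * (m ! * n !)) (+-comm m n) ⟩
    ((n + m) C m) * (m ! * n !)   ≡⟨ [m+n]Cn*[n!*m!]≡[m+n]! n m ⟩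
    (n + m) !                     ≡⟨ ≡.cong _! (+-comm n m) ⟩
    (m + n) !                     ∎

  -- Both sides equal (i+q+r)! / (i! q! r!).
  [i+q]Cq*[i+q+r]Cr≡[i+q+r]C[q+r]*[q+r]Cq : ∀ i q r →
    ((i + q) C q) * ((i + q + r) C r) ≡ ((i + (q + r)) C (q + r)) * ((q + r) C q)
  [i+q]Cq*[i+q+r]Cr≡[i+q+r]C[q+r]*[q+r]Cq i q r = *-cancelʳ-≡ _ _ (r ! * (q ! * i !)) (begin
    ((i + q) C q) * ((i + q + r) C r) * (r ! * (q ! * i !))
      ≡⟨ solve 5 (λ x y a b c → x :* y :* (a :* (b :* c)) := y :* (a :* (x :* (b :* c)))) ≡.refl
           ((i + q) C q) ((i + q + r) C r) (r !) (q !) (i !) ⟩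
    ((i + q + r) C r) * (r ! * (((i + q) C q) * (q ! * i !)))
      ≡⟨ ≡.cong (λ k → ((i + q + r) C r) * (r ! * k)) ([m+n]Cn*[n!*m!]≡[m+n]! i q) ⟩
    ((i + q + r) C r) * (r ! * (i + q) !)
      ≡⟨ [m+n]Cn*[n!*m!]≡[m+n]! (i + q) r ⟩
    (i + q + r) !
      ≡⟨ ≡.cong _! (+-assoc i q r) ⟩
    (i + (q + r)) !
      ≡⟨ [m+n]Cn*[n!*m!]≡[m+n]! i (q + r) ⟨
    ((i + (q + r)) C (q + r)) * ((q + r) ! * i !)
      ≡⟨ ≡.cong (λ k → ((i + (q + r)) C (q + r)) * (k * i !)) ([m+n]Cm*[m!*n!]≡[m+n]! q r) ⟨
    ((i + (q + r)) C (q + r)) * (((q + r) C q) * (q ! * r !) * i !)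
      ≡⟨ solve 5 (λ x y a b c → x :* (y :* (b :* a) :* c) := x :* y :* (a :* (b :* c))) ≡.refl
           ((i + (q + r)) C (q + r)) ((q + r) C q) (r !) (q !) (i !) ⟩
    ((i + (q + r)) C (q + r)) * ((q + r) C q) * (r ! * (q ! * i !)) ∎)
    where
    open +-*-Solver
    instance _ = m*n≢0 (r !) (q ! * i !) {{r !≢0}} {{q !* i !≢0}}

data Offset (i : ℕ) : ℕ → Set where
  i+_ : ∀ s → Offset i (i ℕ.+ s)
  <i  : ∀ {m} → m < i → Offset i m

offset : ∀ i m → Offset i m
offset zero    m       = i+ m
offset (suc i) zero    = <i z<s
offset (suc i) (suc m) with offset i m
... | i+ s   = i+ s
... | <i m<i = <i (s≤s m<i)


module Sums {c ℓ} (R : CommutativeRing c ℓ) where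

  open CommutativeRing R
  open WithRing R using (ringOps)
  open import Algebra.Properties.Monoid.Sum +-monoid
    using (sum; sum-cong-≋; sum-cong-≗; sum-replicate; sum-replicate-zero; sum-init-last)
  open import Algebra.Properties.CommutativeMonoid.Sum +-commutativeMonoid
    using (∑-distrib-+) renaming (∑-comm to sum-comm)
  open import Algebra.Properties.Semiring.Sum semiring using (*-distribˡ-sum)
  open import Algebra.Properties.Semiring.Mult semiring public
    using (_×_; ×-cong; ×-congʳ; ×-congˡ; ×-homo-+; ×-assocˡ; ×-homo-1; ×-comm-*; ×-assoc-*)
  open import Algebra.Properties.CommutativeMonoid.Mult +-commutativeMonoid public
    using (×-distrib-+)
  open import Relation.Binary.Reasoning.Setoid setoid

  -- ∑ n g = g 0 + ⋯ + g (n - 1), kept opaque so that unification does not unfold it.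
  opaque
    ∑ : ℕ → (ℕ → Carrier) → Carrier
    ∑ n g = sum {n} (λ i → g (toℕ i))

    ∑-cong< : ∀ n {g h : ℕ → Carrier} → (∀ i → i < n → g i ≈ h i) → ∑ n g ≈ ∑ n h
    ∑-cong< n e = sum-cong-≋ (λ i → e (toℕ i) (toℕ<n i))

    ∑-cong : ∀ n {g h : ℕ → Carrier} → (∀ i → g i ≈ h i) → ∑ n g ≈ ∑ n h
    ∑-cong n e = ∑-cong< n (λ i _ → e i)

    ∑-zero : ∀ n {g : ℕ → Carrier} → (∀ i → i < n → g i ≈ 0#) → ∑ n g ≈ 0#
    ∑-zero n e = trans (∑-cong< n e) (sum-replicate-zero n)

    ∑-+ : ∀ n (g h : ℕ → Carrier) → ∑ n (λ i → g i + h i) ≈ ∑ n g + ∑ n h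
    ∑-+ n g h = ∑-distrib-+ {n} (g ∘ toℕ) (h ∘ toℕ)

    ∑-comm : ∀ m n (g : ℕ → ℕ → Carrier) → ∑ m (λ i → ∑ n (g i)) ≈ ∑ n (λ j → ∑ m (λ i → g i j))
    ∑-comm m n g = sum-comm {m} {n} (λ i j → g (toℕ i) (toℕ j))

    *-distribˡ-∑ : ∀ n x (g : ℕ → Carrier) → x * ∑ n g ≈ ∑ n (λ i → x * g i)
    *-distribˡ-∑ n x g = *-distribˡ-sum {n} x (g ∘ toℕ)

    ∑-0 : ∀ (g : ℕ → Carrier) → ∑ 0 g ≡ 0#
    ∑-0 g = ≡.refl

    ∑-suc : ∀ n (g : ℕ → Carrier) → ∑ (suc n) g ≡ g 0 + ∑ n (g ∘ suc)
    ∑-suc n g = ≡.refl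

    ∑-last : ∀ n (g : ℕ → Carrier) → ∑ (suc n) g ≈ ∑ n g + g n
    ∑-last n g = trans (sum-init-last {n} (g ∘ toℕ)) (reflexive (≡.cong₂ _+_
      (sum-cong-≗ {n} (λ i → ≡.cong g (toℕ-inject₁ i))) (≡.cong g (toℕ-fromℕ n))))

  ∑-shift : ∀ n (g : ℕ → Carrier) → g 0 ≈ 0# → g (suc n) ≈ 0# → ∑ (suc n) g ≈ ∑ (suc n) (g ∘ suc)
  ∑-shift n g g₀ gₙ₊₁ = begin
    ∑ (suc n) g                  ≡⟨ ∑-suc n g ⟩
    g 0 + ∑ n (g ∘ suc)          ≈⟨ +-congʳ g₀ ⟩
    0# + ∑ n (g ∘ suc)           ≈⟨ +-comm _ _ ⟩
    ∑ n (g ∘ suc) + 0#           ≈⟨ +-congˡ gₙ₊₁ ⟨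
    ∑ n (g ∘ suc) + g (suc n)    ≈⟨ ∑-last n (g ∘ suc) ⟨
    ∑ (suc n) (g ∘ suc)          ∎

  ∑-split : ∀ m n (g : ℕ → Carrier) → ∑ (m ℕ.+ n) g ≈ ∑ m g + ∑ n (λ i → g (m ℕ.+ i))
  ∑-split zero    n g = trans (sym (+-identityˡ _)) (+-congʳ (reflexive (≡.sym (∑-0 g))))
  ∑-split (suc m) n g = begin
    ∑ (suc m ℕ.+ n) g                                   ≡⟨ ∑-suc (m ℕ.+ n) g ⟩
    g 0 + ∑ (m ℕ.+ n) (g ∘ suc)                          ≈⟨ +-congˡ (∑-split m n (g ∘ suc)) ⟩
    g 0 + (∑ m (g ∘ suc) + ∑ n (λ i → g (suc m ℕ.+ i)))  ≈⟨ +-assoc _ _ _ ⟨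
    g 0 + ∑ m (g ∘ suc) + ∑ n (λ i → g (suc m ℕ.+ i))    ≡⟨ ≡.cong (_+ ∑ n (λ i → g (suc m ℕ.+ i))) (∑-suc m g) ⟨
    ∑ (suc m) g + ∑ n (λ i → g (suc m ℕ.+ i))            ∎

  ×-zeroʳ : ∀ n → n × 0# ≈ 0#
  ×-zeroʳ n = trans (sym (sum-replicate n)) (sum-replicate-zero n)

  ×-∑ : ∀ k n (g : ℕ → Carrier) → k × ∑ n g ≈ ∑ n (λ i → k × g i)
  ×-∑ k zero    g = trans (×-congʳ k (reflexive (∑-0 g))) (trans (×-zeroʳ k) (reflexive (≡.sym (∑-0 _))))
  ×-∑ k (suc n) g = begin
    k × ∑ (suc n) g                       ≡⟨ ≡.cong (k ×_) (∑-suc n g) ⟩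
    k × (g 0 + ∑ n (g ∘ suc))             ≈⟨ ×-distrib-+ _ _ k ⟩
    k × g 0 + k × ∑ n (g ∘ suc)           ≈⟨ +-congˡ (×-∑ k n (g ∘ suc)) ⟩
    k × g 0 + ∑ n (λ i → k × g (suc i))   ≡⟨ ∑-suc n _ ⟨
    ∑ (suc n) (λ i → k × g i)             ∎

  natMul≡× : ∀ n x → natMul ringOps n x ≡ n × x
  natMul≡× zero    x = ≡.refl
  natMul≡× (suc n) x = ≡.cong (x +_) (natMul≡× n x)

  sumTo≡∑ : ∀ n (g : ℕ → Carrier) → sumTo ringOps n g ≡ ∑ (suc n) g
  sumTo≡∑ n g = ≡.trans (≡.cong (foldr _+_ 0#) (List.map-upTo g (suc n))) (foldr-applyUpTo (suc n) g)
    where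
    foldr-applyUpTo : ∀ n (g : ℕ → Carrier) → foldr _+_ 0# (applyUpTo g n) ≡ ∑ n g
    foldr-applyUpTo zero    g = ≡.sym (∑-0 g)
    foldr-applyUpTo (suc n) g = ≡.trans (≡.cong (g 0 +_) (foldr-applyUpTo n (g ∘ suc))) (≡.sym (∑-suc n g))

module AdditiveMap {c ℓ c′ ℓ′} (R : CommutativeRing c ℓ) (R′ : CommutativeRing c′ ℓ′) where

  private
    module A = CommutativeRing R
    module B = CommutativeRing R′
    module ∑A = Sums R
    module ∑B = Sums R′

  module _ (F : A.Carrier → B.Carrier) (F-0# : F A.0# B.≈ B.0#)
           (F-+ : ∀ x y → F (x A.+ y) B.≈ F x B.+ F y) where

    ∑-homo : ∀ n (g : ℕ → A.Carrier) → F (∑A.∑ n g) B.≈ ∑B.∑ n (F ∘ g)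
    ∑-homo zero    g = B.trans (B.reflexive (≡.cong F (∑A.∑-0 g))) (B.trans F-0# (B.reflexive (≡.sym (∑B.∑-0 _))))
    ∑-homo (suc n) g = B.trans (B.reflexive (≡.cong F (∑A.∑-suc n g))) (B.trans (F-+ _ _)
      (B.trans (B.+-congˡ (∑-homo n (g ∘ suc))) (B.reflexive (≡.sym (∑B.∑-suc n _)))))

    ×-homo : ∀ k x → F (k ∑A.× x) B.≈ k ∑B.× F x
    ×-homo zero    x = F-0#
    ×-homo (suc k) x = B.trans (F-+ _ _) (B.+-congˡ (×-homo k x))

module ExponentialSeries {c ℓ} (R : CommutativeRing c ℓ) where

  open CommutativeRing R
  open WithRing R using (Series; _≈ˢ_)
  open Sums R
  open import Algebra.Properties.CommutativeSemigroup +-commutativeSemigroup using (x∙yz≈y∙xz)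
  open import Algebra.Properties.CommutativeSemigroup *-commutativeSemigroup public
    using () renaming (x∙yz≈y∙xz to x*yz≈y*xz)

  module ≈-Reasoning = Relation.Binary.Reasoning.Setoid setoid
  open ≈-Reasoning

  infixl 6 _⊕_
  infixl 7 _⊛_

  _⊕_ : Series → Series → Series
  (a ⊕ b) n = a n + b n

  ⊖_ : Series → Series
  (⊖ a) n = - a n

  𝟘 : Series
  𝟘 _ = 0#

  𝟙 : Series
  𝟙 zero    = 1#
  𝟙 (suc _) = 0#

  δ : Series → Series
  δ a n = a (suc n)

  opaque
    _⊛_ : Series → Series → Series
    (a ⊛ b) n = ∑ (suc n) (λ i → (n C i) × (a i * b (n ∸ i)))

    ⊛-def : ∀ a b n → (a ⊛ b) n ≡ ∑ (suc n) (λ i → (n C i) × (a i * b (n ∸ i)))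
    ⊛-def a b n = ≡.refl

    ⊛-cong≤ : ∀ n {a a′ b b′} → (∀ i → i ≤ n → a i ≈ a′ i) → (∀ i → i ≤ n → b i ≈ b′ i) →
              (a ⊛ b) n ≈ (a′ ⊛ b′) n
    ⊛-cong≤ n ea eb = ∑-cong< (suc n) (λ i i<1+n →
      ×-congʳ (n C i) (*-cong (ea i (ℕ.s≤s⁻¹ i<1+n)) (eb (n ∸ i) (ℕ.m∸n≤m n i))))

    ⊛-cong : ∀ {a a′ b b′} → a ≈ˢ a′ → b ≈ˢ b′ → (a ⊛ b) ≈ˢ (a′ ⊛ b′)
    ⊛-cong ea eb n = ⊛-cong≤ n (λ i _ → ea i) (λ i _ → eb i)

    ⊛-at-0 : ∀ a b → (a ⊛ b) 0 ≈ a 0 * b 0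
    ⊛-at-0 a b = trans (reflexive (∑-suc 0 _)) (trans (+-cong (+-identityʳ _) (reflexive (∑-0 _))) (+-identityʳ _))

    ⊛-zeroˡ : ∀ a → (𝟘 ⊛ a) ≈ˢ 𝟘
    ⊛-zeroˡ a n = ∑-zero (suc n) (λ i _ → trans (×-congʳ (n C i) (zeroˡ _)) (×-zeroʳ (n C i)))

    ⊛-distribʳ : ∀ d a b → ((a ⊕ b) ⊛ d) ≈ˢ (a ⊛ d ⊕ b ⊛ d)
    ⊛-distribʳ d a b n = trans
      (∑-cong (suc n) (λ i → trans (×-congʳ (n C i) (distribʳ _ _ _)) (×-distrib-+ _ _ (n C i))))
      (∑-+ (suc n) _ _)

    -- Pascal's rule C(n+1,i+1) = C(n,i) + C(n,i+1) splits the product into the two Leibniz terms.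
    δ-⊛ : ∀ a b → δ (a ⊛ b) ≈ˢ (δ a ⊛ b ⊕ a ⊛ δ b)
    δ-⊛ a b n = begin
      (a ⊛ b) (suc n)                                                 ≡⟨ ∑-suc (suc n) _ ⟩
      1 × (a 0 * b (suc n)) + ∑ (suc n) (λ i → (suc n C suc i) × t i)
        ≈⟨ +-congˡ (∑-cong (suc n) (λ i → trans
             (×-congˡ (≡.sym (nCk+nC[k+1]≡[n+1]C[k+1] n i))) (×-homo-+ (t i) (n C i) (n C suc i)))) ⟩
      1 × (a 0 * b (suc n)) + ∑ (suc n) (λ i → (n C i) × t i + (n C suc i) × t i)
        ≈⟨ +-congˡ (∑-+ (suc n) _ _) ⟩
      1 × (a 0 * b (suc n)) + ((δ a ⊛ b) n + ∑ (suc n) (λ i → (n C suc i) × t i))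
        ≈⟨ x∙yz≈y∙xz _ _ _ ⟩
      (δ a ⊛ b) n + (1 × (a 0 * b (suc n)) + ∑ (suc n) (λ i → (n C suc i) × t i))
        ≈⟨ +-congˡ (+-congˡ (∑-last n _)) ⟩
      (δ a ⊛ b) n + (1 × (a 0 * b (suc n)) + (∑ n (λ i → (n C suc i) × t i) + (n C suc n) × t n))
        ≈⟨ +-congˡ (+-congˡ (trans (+-congˡ (×-congˡ (k>n⇒nCk≡0 (ℕ.n<1+n n)))) (+-identityʳ _))) ⟩
      (δ a ⊛ b) n + (1 × (a 0 * b (suc n)) + ∑ n (λ i → (n C suc i) × t i))
        ≈⟨ +-congˡ (+-congˡ (∑-cong< n (λ i i<n →
             ×-congʳ (n C suc i) (*-congˡ (reflexive (≡.cong b (ℕ.+-∸-assoc 1 i<n))))))) ⟩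
      (δ a ⊛ b) n + (1 × (a 0 * b (suc n)) + ∑ n (λ i → (n C suc i) × (a (suc i) * b (suc (n ∸ suc i)))))
        ≡⟨ ≡.cong ((δ a ⊛ b) n +_) (∑-suc n _) ⟨
      (δ a ⊛ b) n + (a ⊛ δ b) n ∎
      where
      t : ℕ → Carrier
      t i = a (suc i) * b (n ∸ i)

  ⊛-comm : ∀ a b → (a ⊛ b) ≈ˢ (b ⊛ a)
  ⊛-comm a b zero    = trans (⊛-at-0 a b) (trans (*-comm _ _) (sym (⊛-at-0 b a)))
  ⊛-comm a b (suc n) = begin
    (a ⊛ b) (suc n)               ≈⟨ δ-⊛ a b n ⟩
    (δ a ⊛ b) n + (a ⊛ δ b) n     ≈⟨ +-cong (⊛-comm (δ a) b n) (⊛-comm a (δ b) n) ⟩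
    (b ⊛ δ a) n + (δ b ⊛ a) n     ≈⟨ +-comm _ _ ⟩
    (δ b ⊛ a) n + (b ⊛ δ a) n     ≈⟨ δ-⊛ b a n ⟨
    (b ⊛ a) (suc n)               ∎

  ⊛-identityˡ : ∀ a → (𝟙 ⊛ a) ≈ˢ a
  ⊛-identityˡ a zero    = trans (⊛-at-0 𝟙 a) (*-identityˡ _)
  ⊛-identityˡ a (suc n) = trans (δ-⊛ 𝟙 a n)
    (trans (+-cong (⊛-zeroˡ a n) (⊛-identityˡ (δ a) n)) (+-identityˡ _))

  ⊛-distribˡ : ∀ d a b → (d ⊛ (a ⊕ b)) ≈ˢ (d ⊛ a ⊕ d ⊛ b)
  ⊛-distribˡ d a b n = trans (⊛-comm d (a ⊕ b) n)
    (trans (⊛-distribʳ d a b n) (+-cong (⊛-comm a d n) (⊛-comm b d n)))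

  ⊛-assoc : ∀ a b d → ((a ⊛ b) ⊛ d) ≈ˢ (a ⊛ (b ⊛ d))
  ⊛-assoc a b d zero = begin
    ((a ⊛ b) ⊛ d) 0     ≈⟨ trans (⊛-at-0 (a ⊛ b) d) (*-congʳ (⊛-at-0 a b)) ⟩
    (a 0 * b 0) * d 0   ≈⟨ *-assoc _ _ _ ⟩
    a 0 * (b 0 * d 0)   ≈⟨ trans (⊛-at-0 a (b ⊛ d)) (*-congˡ (⊛-at-0 b d)) ⟨
    (a ⊛ (b ⊛ d)) 0     ∎
  ⊛-assoc a b d (suc n) = begin
    ((a ⊛ b) ⊛ d) (suc n)
      ≈⟨ δ-⊛ (a ⊛ b) d n ⟩
    (δ (a ⊛ b) ⊛ d) n + ((a ⊛ b) ⊛ δ d) n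
      ≈⟨ +-congʳ (trans (⊛-cong (δ-⊛ a b) (λ _ → refl) n) (⊛-distribʳ d _ _ n)) ⟩
    ((δ a ⊛ b) ⊛ d) n + ((a ⊛ δ b) ⊛ d) n + ((a ⊛ b) ⊛ δ d) n
      ≈⟨ +-cong (+-cong (⊛-assoc (δ a) b d n) (⊛-assoc a (δ b) d n)) (⊛-assoc a b (δ d) n) ⟩
    (δ a ⊛ (b ⊛ d)) n + (a ⊛ (δ b ⊛ d)) n + (a ⊛ (b ⊛ δ d)) n
      ≈⟨ +-assoc _ _ _ ⟩
    (δ a ⊛ (b ⊛ d)) n + ((a ⊛ (δ b ⊛ d)) n + (a ⊛ (b ⊛ δ d)) n)
      ≈⟨ +-congˡ (trans (⊛-cong (λ _ → refl) (δ-⊛ b d) n) (⊛-distribˡ a _ _ n)) ⟨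
    (δ a ⊛ (b ⊛ d)) n + (a ⊛ δ (b ⊛ d)) n
      ≈⟨ δ-⊛ a (b ⊛ d) n ⟨
    (a ⊛ (b ⊛ d)) (suc n) ∎

  open import Algebra.Construct.Pointwise ℕ using (isAbelianGroup)

  expSeriesRing : CommutativeRing c ℓ
  expSeriesRing = record
    { Carrier = Series ; _≈_ = _≈ˢ_ ; _+_ = _⊕_ ; _*_ = _⊛_ ; -_ = ⊖_ ; 0# = 𝟘 ; 1# = 𝟙
    ; isCommutativeRing = record
      { isRing = record
        { +-isAbelianGroup = isAbelianGroup +-isAbelianGroup
        ; *-cong = ⊛-cong
        ; *-assoc = ⊛-assoc
        ; *-identity = ⊛-identityˡ , (λ a n → trans (⊛-comm a 𝟙 n) (⊛-identityˡ a n))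
        ; distrib = ⊛-distribˡ , ⊛-distribʳ
        }
      ; *-comm = ⊛-comm
      }
    }

  seriesOps : BellOps Series
  seriesOps = WithRing.ringOps expSeriesRing

  module 𝕊 where
    open CommutativeRing expSeriesRing public
    open Sums expSeriesRing public
    open import Algebra.Properties.CommutativeSemigroup
      (CommutativeRing.*-commutativeSemigroup expSeriesRing) public
      using () renaming (x∙yz≈y∙xz to x*yz≈y*xz)

  module ≈ˢ-Reasoning = Relation.Binary.Reasoning.Setoid 𝕊.setoid

  ⊛-zeroʳ-≤ : ∀ n a {b} → (∀ i → i ≤ n → b i ≈ 0#) → (a ⊛ b) n ≈ 0#
  ⊛-zeroʳ-≤ n a e = trans (⊛-cong≤ n (λ _ _ → refl) e) (𝕊.zeroʳ a n)

  ≈ˢ-by-δ : ∀ {a b} → a 0 ≈ b 0 → δ a ≈ˢ δ b → a ≈ˢ b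
  ≈ˢ-by-δ e₀ eδ zero    = e₀
  ≈ˢ-by-δ e₀ eδ (suc n) = eδ n

  ×ˢ-at : ∀ k a n → (k 𝕊.× a) n ≈ k × a n
  ×ˢ-at k a n = AdditiveMap.×-homo expSeriesRing R (λ b → b n) refl (λ _ _ → refl) k a

  ∑ˢ-at : ∀ N g n → 𝕊.∑ N g n ≈ ∑ N (λ i → g i n)
  ∑ˢ-at N g n = AdditiveMap.∑-homo expSeriesRing R (λ b → b n) refl (λ _ _ → refl) N g

  δ-× : ∀ k a → δ (k 𝕊.× a) ≈ˢ (k 𝕊.× δ a)
  δ-× = AdditiveMap.×-homo expSeriesRing expSeriesRing δ (λ _ → refl) (λ _ _ _ → refl)

  δ-∑ : ∀ N g → δ (𝕊.∑ N g) ≈ˢ 𝕊.∑ N (δ ∘ g)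
  δ-∑ = AdditiveMap.∑-homo expSeriesRing expSeriesRing δ (λ _ → refl) (λ _ _ _ → refl)

  constˢ : Carrier → Series
  constˢ x zero    = x
  constˢ x (suc _) = 0#

  constˢ-⊛ : ∀ x a n → (constˢ x ⊛ a) n ≈ x * a n
  constˢ-⊛ x a n = begin
    (constˢ x ⊛ a) n
      ≡⟨ ≡.trans (⊛-def _ _ n) (∑-suc n _) ⟩
    1 × (x * a n) + ∑ n (λ i → (n C suc i) × (0# * a (n ∸ suc i)))
      ≈⟨ +-cong (×-homo-1 _) (∑-zero n (λ i _ → trans (×-congʳ (n C suc i) (zeroˡ _)) (×-zeroʳ (n C suc i)))) ⟩
    x * a n + 0#
      ≈⟨ +-identityʳ _ ⟩
    x * a n
      ∎

  -- tʳ/r!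
  t^[_] : ℕ → Series
  t^[ zero  ]         = 𝟙
  t^[ suc r ] zero    = 0#
  t^[ suc r ] (suc n) = t^[ r ] n

  t^[]-sym : ∀ r i → t^[ r ] i ≡ t^[ i ] r
  t^[]-sym zero    zero    = ≡.refl
  t^[]-sym zero    (suc i) = ≡.refl
  t^[]-sym (suc r) zero    = ≡.refl
  t^[]-sym (suc r) (suc i) = t^[]-sym r i

  t^[+]-at : ∀ i s → t^[ i ℕ.+ s ] i ≡ 𝟙 s
  t^[+]-at zero    zero    = ≡.refl
  t^[+]-at zero    (suc s) = ≡.refl
  t^[+]-at (suc i) s       = t^[+]-at i s

  t^[]-above : ∀ {m i} → m < i → t^[ m ] i ≡ 0#
  t^[]-above {zero}  {suc i} _         = ≡.refl
  t^[]-above {suc m} {suc i} (s≤s m<i) = t^[]-above m<i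

  ∑-t^[] : ∀ r {N} (x : ℕ → Carrier) → r < N → ∑ N (λ j → t^[ r ] j * x j) ≈ x r
  ∑-t^[] zero    {suc N} x _ = begin
    ∑ (suc N) (λ j → t^[ 0 ] j * x j)              ≡⟨ ∑-suc N _ ⟩
    1# * x 0 + ∑ N (λ j → 0# * x (suc j))          ≈⟨ +-cong (*-identityˡ _) (∑-zero N (λ j _ → zeroˡ _)) ⟩
    x 0 + 0#                                       ≈⟨ +-identityʳ _ ⟩
    x 0                                            ∎
  ∑-t^[] (suc r) {suc N} x (s≤s r<N) = begin
    ∑ (suc N) (λ j → t^[ suc r ] j * x j)          ≡⟨ ∑-suc N _ ⟩
    0# * x 0 + ∑ N (λ j → t^[ r ] j * x (suc j))   ≈⟨ +-cong (zeroˡ _) (∑-t^[] r (x ∘ suc) r<N) ⟩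
    0# + x (suc r)                                 ≈⟨ +-identityˡ _ ⟩
    x (suc r)                                      ∎

  t^[]-below : ∀ {r j} → j < r → t^[ r ] j ≡ 0#
  t^[]-below {r} j<r = ≡.trans (t^[]-sym r _) (t^[]-above j<r)

  ∑-t^[]-zero : ∀ r {N} (x : ℕ → Carrier) → N ≤ r → ∑ N (λ j → t^[ r ] j * x j) ≈ 0#
  ∑-t^[]-zero r {N} x N≤r = ∑-zero N (λ j j<N →
    trans (*-congʳ (reflexive (t^[]-below (ℕ.<-≤-trans j<N N≤r)))) (zeroˡ _))

  ⊛-cancelˡ : ∀ p {q a b} → p 0 * q ≈ 1# → (p ⊛ a) ≈ˢ (p ⊛ b) → a ≈ˢ b
  ⊛-cancelˡ p {q} {a} {b} p₀q≈1 pa≈pb = <-rec (λ m → a m ≈ b m) step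
    where
    open import Algebra.Properties.Group +-group using (∙-cancelʳ)
    step : ∀ m → (∀ {i} → i < m → a i ≈ b i) → a m ≈ b m
    step m IH = begin
      a m                ≈⟨ *-identityˡ _ ⟨
      1# * a m           ≈⟨ *-congʳ (trans (*-comm _ _) p₀q≈1) ⟨
      q * p 0 * a m      ≈⟨ *-assoc _ _ _ ⟩
      q * (p 0 * a m)    ≈⟨ *-congˡ p₀a≈p₀b ⟩
      q * (p 0 * b m)    ≈⟨ *-assoc _ _ _ ⟨
      q * p 0 * b m      ≈⟨ *-congʳ (trans (*-comm _ _) p₀q≈1) ⟩
      1# * b m           ≈⟨ *-identityˡ _ ⟩
      b m                ∎
      where
      higher : Series → Carrier
      higher x = ∑ m (λ i → (m C suc i) × (p (suc i) * x (m ∸ suc i)))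
      split : ∀ x → (p ⊛ x) m ≈ p 0 * x m + higher x
      split x = trans (reflexive (≡.trans (⊛-def p x m) (∑-suc m _))) (+-congʳ (×-homo-1 _))
      higher-eq : higher a ≈ higher b
      higher-eq = ∑-cong< m (λ i i<m → ×-congʳ (m C suc i) (*-congˡ (IH (ℕ.∸-monoʳ-< {o = 0} z<s i<m))))
      p₀a≈p₀b : p 0 * a m ≈ p 0 * b m
      p₀a≈p₀b = ∙-cancelʳ (higher a) _ _
        (trans (sym (split a)) (trans (pa≈pb m) (trans (split b) (+-congˡ (sym higher-eq)))))

module CongruentBellOps {b ℓ} (S : Setoid b ℓ) (O : BellOps (Setoid.Carrier S)) where

  open Setoid S
  open BellOps O

  module _ (⊕-cong : ∀ {x x′ y y′} → x ≈ x′ → y ≈ y′ → (x ⊕ y) ≈ (x′ ⊕ y′))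
           (⊗-cong : ∀ {x x′ y y′} → x ≈ x′ → y ≈ y′ → (x ⊗ y) ≈ (x′ ⊗ y′)) where

    natMul-cong : ∀ k {x y} → x ≈ y → natMul O k x ≈ natMul O k y
    natMul-cong zero    e = refl
    natMul-cong (suc k) e = ⊕-cong e (natMul-cong k e)

    sumTo-cong : ∀ n {g h : ℕ → Carrier} → (∀ i → g i ≈ h i) → sumTo O n g ≈ sumTo O n h
    sumTo-cong n {g} {h} e = foldr-map-cong (upTo (suc n))
      where
      foldr-map-cong : ∀ xs → foldr _⊕_ zero# (map g xs) ≈ foldr _⊕_ zero# (map h xs)
      foldr-map-cong []       = refl
      foldr-map-cong (x ∷ xs) = ⊕-cong (e x) (foldr-map-cong xs)

    bell-cong : ∀ {y y′ : ℕ → Carrier} → (∀ j → y j ≈ y′ j) → ∀ n k → bell O y n k ≈ bell O y′ n k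
    bell-cong e zero    zero    = refl
    bell-cong e zero    (suc k) = refl
    bell-cong e (suc n) zero    = refl
    bell-cong e (suc n) (suc k) = sumTo-cong n (λ i →
      natMul-cong (n C i) (⊗-cong (e (suc i)) (bell-cong e (n ∸ i) k)))

module BellOpsHomomorphism {a b ℓ} {A : Set a} (OA : BellOps A)
                           (S : Setoid b ℓ) (OB : BellOps (Setoid.Carrier S)) where

  open Setoid S
  private
    module A = BellOps OA
    module B = BellOps OB

  module Additive (⊕-cong : ∀ {x x′ y y′} → x ≈ x′ → y ≈ y′ → (x B.⊕ y) ≈ (x′ B.⊕ y′))
                  (F : A → Carrier) (F-zero# : F A.zero# ≈ B.zero#)
                  (F-⊕ : ∀ x y → F (x A.⊕ y) ≈ (F x B.⊕ F y)) where

    natMul-homo : ∀ k x → F (natMul OA k x) ≈ natMul OB k (F x)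
    natMul-homo zero    x = F-zero#
    natMul-homo (suc k) x = trans (F-⊕ _ _) (⊕-cong refl (natMul-homo k x))

    sumTo-homo : ∀ n (g : ℕ → A) → F (sumTo OA n g) ≈ sumTo OB n (F ∘ g)
    sumTo-homo n g = foldr-map-homo (upTo (suc n))
      where
      foldr-map-homo : ∀ xs → F (foldr A._⊕_ A.zero# (map g xs)) ≈ foldr B._⊕_ B.zero# (map (F ∘ g) xs)
      foldr-map-homo []       = F-zero#
      foldr-map-homo (x ∷ xs) = trans (F-⊕ _ _) (⊕-cong refl (foldr-map-homo xs))

  module Multiplicative (⊕-cong : ∀ {x x′ y y′} → x ≈ x′ → y ≈ y′ → (x B.⊕ y) ≈ (x′ B.⊕ y′))
                        (⊗-cong : ∀ {x x′ y y′} → x ≈ x′ → y ≈ y′ → (x B.⊗ y) ≈ (x′ B.⊗ y′))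
                        (F : A → Carrier) (F-zero# : F A.zero# ≈ B.zero#) (F-one# : F A.one# ≈ B.one#)
                        (F-⊕ : ∀ x y → F (x A.⊕ y) ≈ (F x B.⊕ F y))
                        (F-⊗ : ∀ x y → F (x A.⊗ y) ≈ (F x B.⊗ F y)) where

    open Additive ⊕-cong F F-zero# F-⊕
    open CongruentBellOps S OB using (natMul-cong; sumTo-cong)

    bell-homo : ∀ y n k → F (bell OA y n k) ≈ bell OB (F ∘ y) n k
    bell-homo y zero    zero    = F-one#
    bell-homo y zero    (suc k) = F-zero#
    bell-homo y (suc n) zero    = F-zero#
    bell-homo y (suc n) (suc k) = trans (sumTo-homo n _) (sumTo-cong ⊕-cong ⊗-cong n (λ i →
      trans (natMul-homo (n C i) _) (natMul-cong ⊕-cong ⊗-cong (n C i)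
        (trans (F-⊗ _ _) (⊗-cong refl (bell-homo y (n ∸ i) k))))))

module DividedPowers {c ℓ} (R : CommutativeRing c ℓ) where

  open CommutativeRing R
  open WithRing R using (Series; _≈ˢ_; ringOps)
  open Sums R
  open ExponentialSeries R

  infix 9 _^[_]

  -- (y ^[ k ]) n = B_{n,k}(y 1, y 2, …): the exponential series of yᵏ/k!, ignoring y 0.
  _^[_] : Series → ℕ → Series
  (y ^[ k ]) n = bell ringOps y n k

  ^[]-cong : ∀ {y y′} → y ≈ˢ y′ → ∀ k → (y ^[ k ]) ≈ˢ (y′ ^[ k ])
  ^[]-cong e k n = CongruentBellOps.bell-cong setoid ringOps +-cong *-cong e n k

  ^[0] : ∀ y → (y ^[ 0 ]) ≈ˢ 𝟙
  ^[0] y zero    = refl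
  ^[0] y (suc n) = refl

  δ-^[suc] : ∀ y k → δ (y ^[ suc k ]) ≈ˢ (δ y ⊛ y ^[ k ])
  δ-^[suc] y k n = begin
    sumTo ringOps n (λ i → natMul ringOps (n C i) (y (suc i) * (y ^[ k ]) (n ∸ i)))
      ≡⟨ sumTo≡∑ n _ ⟩
    ∑ (suc n) (λ i → natMul ringOps (n C i) (y (suc i) * (y ^[ k ]) (n ∸ i)))
      ≈⟨ ∑-cong (suc n) (λ i → reflexive (natMul≡× (n C i) _)) ⟩
    ∑ (suc n) (λ i → (n C i) × (δ y i * (y ^[ k ]) (n ∸ i)))
      ≡⟨ ⊛-def (δ y) (y ^[ k ]) n ⟨
    (δ y ⊛ y ^[ k ]) n ∎
    where open ≈-Reasoning

  ^[]-vanish : ∀ y {k n} → n < k → (y ^[ k ]) n ≈ 0#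
  ^[]-vanish y {suc k} {zero}  _         = refl
  ^[]-vanish y {suc k} {suc n} (s≤s n<k) = trans (δ-^[suc] y k n)
    (⊛-zeroʳ-≤ n (δ y) (λ i i≤n → ^[]-vanish y (ℕ.≤-<-trans i≤n n<k)))

  ^[]-⊛-^[] : ∀ y q j → (y ^[ q ] ⊛ y ^[ j ]) ≈ˢ (((q ℕ.+ j) C q) 𝕊.× y ^[ q ℕ.+ j ])
  ^[]-⊛-^[] y zero j = begin
    y ^[ 0 ] ⊛ y ^[ j ]   ≈⟨ 𝕊.*-congʳ (^[0] y) ⟩
    𝟙 ⊛ y ^[ j ]          ≈⟨ 𝕊.*-identityˡ _ ⟩
    y ^[ j ]              ≈⟨ 𝕊.×-homo-1 _ ⟨
    1 𝕊.× y ^[ j ]        ∎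
    where open ≈ˢ-Reasoning
  ^[]-⊛-^[] y (suc q) zero = begin
    y ^[ suc q ] ⊛ y ^[ 0 ]
      ≈⟨ 𝕊.*-congˡ (^[0] y) ⟩
    y ^[ suc q ] ⊛ 𝟙
      ≈⟨ 𝕊.*-identityʳ _ ⟩
    y ^[ suc q ]
      ≈⟨ 𝕊.×-homo-1 _ ⟨
    1 𝕊.× y ^[ suc q ]
      ≈⟨ 𝕊.×-congˡ (nCn≡1 (suc q)) ⟨
    (suc q C suc q) 𝕊.× y ^[ suc q ]
      ≡⟨ ≡.cong (λ s → (s C suc q) 𝕊.× y ^[ s ]) (ℕ.+-identityʳ (suc q)) ⟨
    ((suc q ℕ.+ 0) C suc q) 𝕊.× y ^[ suc q ℕ.+ 0 ]
      ∎
    where open ≈ˢ-Reasoning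
  ^[]-⊛-^[] y (suc q) (suc j) rewrite ℕ.+-suc q j = ≈ˢ-by-δ at-0 (begin
    δ (y ^[ suc q ] ⊛ y ^[ suc j ])
      ≈⟨ δ-⊛ _ _ ⟩
    δ (y ^[ suc q ]) ⊛ y ^[ suc j ] ⊕ y ^[ suc q ] ⊛ δ (y ^[ suc j ])
      ≈⟨ 𝕊.+-cong (𝕊.*-congʳ (δ-^[suc] y q)) (𝕊.*-congˡ (δ-^[suc] y j)) ⟩
    (δ y ⊛ y ^[ q ]) ⊛ y ^[ suc j ] ⊕ y ^[ suc q ] ⊛ (δ y ⊛ y ^[ j ])
      ≈⟨ 𝕊.+-cong (𝕊.*-assoc _ _ _) (𝕊.x*yz≈y*xz _ _ _) ⟩
    δ y ⊛ (y ^[ q ] ⊛ y ^[ suc j ]) ⊕ δ y ⊛ (y ^[ suc q ] ⊛ y ^[ j ])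
      ≈⟨ 𝕊.+-cong (𝕊.*-congˡ (^[]-⊛-^[] y q (suc j))) (𝕊.*-congˡ (^[]-⊛-^[] y (suc q) j)) ⟩
    δ y ⊛ (((q ℕ.+ suc j) C q) 𝕊.× y ^[ q ℕ.+ suc j ]) ⊕ δ y ⊛ ((suc s C suc q) 𝕊.× y ^[ suc s ])
      ≈⟨ 𝕊.+-congʳ (𝕊.*-congˡ (reindex (ℕ.+-suc q j))) ⟩
    δ y ⊛ ((suc s C q) 𝕊.× y ^[ suc s ]) ⊕ δ y ⊛ ((suc s C suc q) 𝕊.× y ^[ suc s ])
      ≈⟨ 𝕊.+-cong (𝕊.×-comm-* (suc s C q) (δ y) (y ^[ suc s ])) (𝕊.×-comm-* (suc s C suc q) (δ y) (y ^[ suc s ])) ⟩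
    (suc s C q) 𝕊.× (δ y ⊛ y ^[ suc s ]) ⊕ (suc s C suc q) 𝕊.× (δ y ⊛ y ^[ suc s ])
      ≈⟨ 𝕊.×-homo-+ (δ y ⊛ y ^[ suc s ]) (suc s C q) (suc s C suc q) ⟨
    ((suc s C q) ℕ.+ (suc s C suc q)) 𝕊.× (δ y ⊛ y ^[ suc s ])
      ≈⟨ 𝕊.×-cong (nCk+nC[k+1]≡[n+1]C[k+1] (suc s) q) (𝕊.sym (δ-^[suc] y (suc s))) ⟩
    (suc (suc s) C suc q) 𝕊.× δ (y ^[ suc (suc s) ])
      ≈⟨ δ-× (suc (suc s) C suc q) (y ^[ suc (suc s) ]) ⟨
    δ ((suc (suc s) C suc q) 𝕊.× y ^[ suc (suc s) ]) ∎)
    where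
    open ≈ˢ-Reasoning
    s : ℕ
    s = q ℕ.+ j
    reindex : ∀ {m n} → m ≡ n → ((m C q) 𝕊.× y ^[ m ]) ≈ˢ ((n C q) 𝕊.× y ^[ n ])
    reindex ≡.refl = 𝕊.refl
    at-0 : (y ^[ suc q ] ⊛ y ^[ suc j ]) 0 ≈ ((suc (suc s) C suc q) 𝕊.× y ^[ suc (suc s) ]) 0
    at-0 = trans (⊛-at-0 _ _) (trans (zeroˡ _) (sym (trans
      (×ˢ-at (suc (suc s) C suc q) (y ^[ suc (suc s) ]) 0) (×-zeroʳ (suc (suc s) C suc q)))))

module BellDerivation {c ℓ} (R : CommutativeRing c ℓ) where

  open CommutativeRing R
  open WithRing R using (Series; _≈ˢ_; ringOps)
  open Sums R
  open ExponentialSeries R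
  open DividedPowers R
  open import Algebra.Properties.Group +-group using (identityˡ-unique)

  module Derivation (D : Carrier → Carrier) (D-cong : ∀ {x y} → x ≈ y → D x ≈ D y)
                    (D-+ : ∀ x y → D (x + y) ≈ D x + D y)
                    (D-* : ∀ x y → D (x * y) ≈ D x * y + x * D y) where

    D-0# : D 0# ≈ 0#
    D-0# = identityˡ-unique (D 0#) (D 0#) (trans (sym (D-+ 0# 0#)) (D-cong (+-identityˡ 0#)))

    D-1# : D 1# ≈ 0#
    D-1# = identityˡ-unique (D 1#) (D 1#) (begin
      D 1# + D 1#            ≈⟨ +-cong (*-identityʳ _) (*-identityˡ _) ⟨
      D 1# * 1# + 1# * D 1#  ≈⟨ D-* 1# 1# ⟨
      D (1# * 1#)            ≈⟨ D-cong (*-identityˡ 1#) ⟩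
      D 1#                   ∎)
      where open ≈-Reasoning

    D̂ : Series → Series
    D̂ a n = D (a n)

    D̂-cong : ∀ {a b} → a ≈ˢ b → D̂ a ≈ˢ D̂ b
    D̂-cong e n = D-cong (e n)

    D̂-⊛ : ∀ a b → D̂ (a ⊛ b) ≈ˢ (D̂ a ⊛ b ⊕ a ⊛ D̂ b)
    D̂-⊛ a b n = begin
      D ((a ⊛ b) n)
        ≡⟨ ≡.cong D (⊛-def a b n) ⟩
      D (∑ (suc n) (λ i → (n C i) × (a i * b (n ∸ i))))
        ≈⟨ AdditiveMap.∑-homo R R D D-0# D-+ (suc n) _ ⟩
      ∑ (suc n) (λ i → D ((n C i) × (a i * b (n ∸ i))))
        ≈⟨ ∑-cong (suc n) (λ i → trans (AdditiveMap.×-homo R R D D-0# D-+ (n C i) _)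
             (trans (×-congʳ (n C i) (D-* _ _)) (×-distrib-+ _ _ (n C i)))) ⟩
      ∑ (suc n) (λ i → (n C i) × (D (a i) * b (n ∸ i)) + (n C i) × (a i * D (b (n ∸ i))))
        ≈⟨ ∑-+ (suc n) _ _ ⟩
      ∑ (suc n) (λ i → (n C i) × (D (a i) * b (n ∸ i))) + ∑ (suc n) (λ i → (n C i) × (a i * D (b (n ∸ i))))
        ≡⟨ ≡.cong₂ _+_ (⊛-def (D̂ a) b n) (⊛-def a (D̂ b) n) ⟨
      (D̂ a ⊛ b) n + (a ⊛ D̂ b) n
        ∎
      where open ≈-Reasoning

    D̂-^[0] : ∀ y → D̂ (y ^[ 0 ]) ≈ˢ 𝟘
    D̂-^[0] y zero    = D-1#
    D̂-^[0] y (suc n) = D-0#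

    δ-constˢ-⊛ : ∀ x a → δ (constˢ x ⊛ a) ≈ˢ (constˢ x ⊛ δ a)
    δ-constˢ-⊛ x a = 𝕊.trans (δ-⊛ (constˢ x) a) (𝕊.trans (𝕊.+-congʳ (⊛-zeroˡ a)) (𝕊.+-identityˡ _))

    module _ (y : Series) (D-y : ∀ j → D (y j) ≈ y (suc j)) where

      δδy≈D̂δy : δ (δ y) ≈ˢ D̂ (δ y)
      δδy≈D̂δy n = sym (D-y (suc n))

      -- Mutual induction on k: the derivative step of each statement uses the other.
      δ-^[suc]≈D̂ : ∀ k → δ (y ^[ suc k ]) ≈ˢ (D̂ (y ^[ suc k ]) ⊕ constˢ (y 1) ⊛ y ^[ k ])
      δy⊛δ-^[] : ∀ k → (δ y ⊛ δ (y ^[ k ])) ≈ˢ (δ y ⊛ D̂ (y ^[ k ]) ⊕ constˢ (y 1) ⊛ δ (y ^[ k ]))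

      δ-^[suc]≈D̂ k = ≈ˢ-by-δ at-0 (begin
        δ (δ (y ^[ suc k ]))
          ≈⟨ (λ n → δ-^[suc] y k (suc n)) ⟩
        δ (δ y ⊛ y ^[ k ])
          ≈⟨ δ-⊛ (δ y) (y ^[ k ]) ⟩
        δ (δ y) ⊛ y ^[ k ] ⊕ δ y ⊛ δ (y ^[ k ])
          ≈⟨ 𝕊.+-cong (𝕊.*-congʳ δδy≈D̂δy) (δy⊛δ-^[] k) ⟩
        D̂ (δ y) ⊛ y ^[ k ] ⊕ (δ y ⊛ D̂ (y ^[ k ]) ⊕ constˢ (y 1) ⊛ δ (y ^[ k ]))
          ≈⟨ 𝕊.+-assoc _ _ _ ⟨
        D̂ (δ y) ⊛ y ^[ k ] ⊕ δ y ⊛ D̂ (y ^[ k ]) ⊕ constˢ (y 1) ⊛ δ (y ^[ k ])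
          ≈⟨ 𝕊.+-cong (𝕊.sym (D̂-⊛ (δ y) (y ^[ k ]))) (𝕊.sym (δ-constˢ-⊛ (y 1) (y ^[ k ]))) ⟩
        D̂ (δ y ⊛ y ^[ k ]) ⊕ δ (constˢ (y 1) ⊛ y ^[ k ])
          ≈⟨ 𝕊.+-congʳ (D̂-cong (λ n → sym (δ-^[suc] y k n))) ⟩
        δ (D̂ (y ^[ suc k ]) ⊕ constˢ (y 1) ⊛ y ^[ k ])
          ∎)
        where
        open ≈ˢ-Reasoning
        at-0 : (y ^[ suc k ]) 1 ≈ D 0# + (constˢ (y 1) ⊛ y ^[ k ]) 0
        at-0 = trans (δ-^[suc] y k 0) (trans (⊛-at-0 _ _)
          (sym (trans (+-cong D-0# (⊛-at-0 _ _)) (+-identityˡ _))))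

      δy⊛δ-^[] zero = begin
        δ y ⊛ δ (y ^[ 0 ])                                   ≈⟨ 𝕊.zeroʳ (δ y) ⟩
        𝟘                                                    ≈⟨ 𝕊.+-identityʳ 𝟘 ⟨
        𝟘 ⊕ 𝟘                                                ≈⟨ 𝕊.+-cong (𝕊.zeroʳ (δ y)) (𝕊.zeroʳ (constˢ (y 1))) ⟨
        δ y ⊛ 𝟘 ⊕ constˢ (y 1) ⊛ 𝟘                           ≈⟨ 𝕊.+-congʳ (𝕊.*-congˡ (D̂-^[0] y)) ⟨
        δ y ⊛ D̂ (y ^[ 0 ]) ⊕ constˢ (y 1) ⊛ δ (y ^[ 0 ])    ∎
        where open ≈ˢ-Reasoning
      δy⊛δ-^[] (suc k) = begin
        δ y ⊛ δ (y ^[ suc k ])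
          ≈⟨ 𝕊.*-congˡ (δ-^[suc]≈D̂ k) ⟩
        δ y ⊛ (D̂ (y ^[ suc k ]) ⊕ constˢ (y 1) ⊛ y ^[ k ])
          ≈⟨ 𝕊.distribˡ _ _ _ ⟩
        δ y ⊛ D̂ (y ^[ suc k ]) ⊕ δ y ⊛ (constˢ (y 1) ⊛ y ^[ k ])
          ≈⟨ 𝕊.+-congˡ (𝕊.x*yz≈y*xz _ _ _) ⟩
        δ y ⊛ D̂ (y ^[ suc k ]) ⊕ constˢ (y 1) ⊛ (δ y ⊛ y ^[ k ])
          ≈⟨ 𝕊.+-congˡ (𝕊.*-congˡ (𝕊.sym (δ-^[suc] y k))) ⟩
        δ y ⊛ D̂ (y ^[ suc k ]) ⊕ constˢ (y 1) ⊛ δ (y ^[ suc k ])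
          ∎
        where open ≈ˢ-Reasoning

      bell-derivation : ∀ n k →
        bell ringOps y (suc n) (suc k) ≈ D (bell ringOps y n (suc k)) + y 1 * bell ringOps y n k
      bell-derivation n k = trans (δ-^[suc]≈D̂ k n) (+-congˡ (constˢ-⊛ (y 1) (y ^[ k ]) n))

module Composition {c ℓ} (R : CommutativeRing c ℓ) where

  open CommutativeRing R
  open WithRing R using (Series; _≈ˢ_; ringOps; compose; tSeries)
  open Sums R
  open ExponentialSeries R
  open DividedPowers R

  compose-def : ∀ g f n → compose g f n ≈ ∑ (suc n) (λ k → g k * (f ^[ k ]) n)
  compose-def g f n = reflexive (sumTo≡∑ n _)

  compose-extend : ∀ g f {n N} → n < N → compose g f n ≈ ∑ N (λ k → g k * (f ^[ k ]) n)
  compose-extend g f {n} n<N with ℕ.m≤n⇒∃[o]m+o≡n n<N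
  ... | e , ≡.refl = begin
    compose g f n                                ≈⟨ compose-def g f n ⟩
    ∑ (suc n) t                                  ≈⟨ +-identityʳ _ ⟨
    ∑ (suc n) t + 0#                             ≈⟨ +-congˡ (∑-zero e vanish) ⟨
    ∑ (suc n) t + ∑ e (λ i → t (suc n ℕ.+ i))    ≈⟨ ∑-split (suc n) e t ⟨
    ∑ (suc n ℕ.+ e) t                            ∎
    where
    open ≈-Reasoning
    t : ℕ → Carrier
    t k = g k * (f ^[ k ]) n
    vanish : ∀ i → i < e → t (suc n ℕ.+ i) ≈ 0#
    vanish i _ = trans (*-congˡ (^[]-vanish f (s≤s (ℕ.m≤m+n n i)))) (zeroʳ _)

  compose-at-0 : ∀ g f → compose g f 0 ≈ g 0
  compose-at-0 g f = trans (compose-def g f 0) (trans (reflexive (∑-suc 0 _))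
    (trans (+-cong (*-identityʳ _) (reflexive (∑-0 _))) (+-identityʳ _)))

  compose-congˡ : ∀ {g g′} f → g ≈ˢ g′ → compose g f ≈ˢ compose g′ f
  compose-congˡ f e n = trans (compose-def _ f n)
    (trans (∑-cong (suc n) (λ k → *-congʳ (e k))) (sym (compose-def _ f n)))

  compose-congʳ : ∀ g {f f′} → f ≈ˢ f′ → compose g f ≈ˢ compose g f′
  compose-congʳ g e n = trans (compose-def g _ n)
    (trans (∑-cong (suc n) (λ k → *-congˡ (^[]-cong e k n))) (sym (compose-def g _ n)))

  δ-compose : ∀ g f → δ (compose g f) ≈ˢ (δ f ⊛ compose (δ g) f)
  δ-compose g f n = begin
    compose g f (suc n)
      ≈⟨ compose-def g f (suc n) ⟩
    ∑ (suc (suc n)) (λ k → g k * (f ^[ k ]) (suc n))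
      ≡⟨ ∑-suc (suc n) _ ⟩
    g 0 * 0# + ∑ (suc n) (λ k → g (suc k) * (f ^[ suc k ]) (suc n))
      ≈⟨ trans (+-congʳ (zeroʳ _)) (+-identityˡ _) ⟩
    ∑ (suc n) (λ k → g (suc k) * (f ^[ suc k ]) (suc n))
      ≈⟨ ∑-cong (suc n) (λ k → *-congˡ (trans (δ-^[suc] f k n) (reflexive (⊛-def _ _ n)))) ⟩
    ∑ (suc n) (λ k → g (suc k) * ∑ (suc n) (λ i → (n C i) × (f (suc i) * (f ^[ k ]) (n ∸ i))))
      ≈⟨ ∑-cong (suc n) (λ k → *-distribˡ-∑ (suc n) _ _) ⟩
    ∑ (suc n) (λ k → ∑ (suc n) (λ i → g (suc k) * ((n C i) × (f (suc i) * (f ^[ k ]) (n ∸ i)))))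
      ≈⟨ ∑-comm (suc n) (suc n) _ ⟩
    ∑ (suc n) (λ i → ∑ (suc n) (λ k → g (suc k) * ((n C i) × (f (suc i) * (f ^[ k ]) (n ∸ i)))))
      ≈⟨ ∑-cong (suc n) (λ i → trans (∑-cong (suc n) (λ k → trans (×-comm-* (n C i) _ _)
           (×-congʳ (n C i) (x*yz≈y*xz _ _ _)))) (sym (×-∑ (n C i) (suc n) _))) ⟩
    ∑ (suc n) (λ i → (n C i) × ∑ (suc n) (λ k → f (suc i) * (g (suc k) * (f ^[ k ]) (n ∸ i))))
      ≈⟨ ∑-cong< (suc n) (λ i _ → ×-congʳ (n C i) (trans (sym (*-distribˡ-∑ (suc n) _ _))
           (*-congˡ (sym (compose-extend (δ g) f (s≤s (ℕ.m∸n≤m n i))))))) ⟩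
    ∑ (suc n) (λ i → (n C i) × (f (suc i) * compose (δ g) f (n ∸ i)))
      ≡⟨ ⊛-def (δ f) (compose (δ g) f) n ⟨
    (δ f ⊛ compose (δ g) f) n
      ∎
    where open ≈-Reasoning

  compose-𝟘 : ∀ f → compose 𝟘 f ≈ˢ 𝟘
  compose-𝟘 f n = trans (compose-def 𝟘 f n) (∑-zero (suc n) (λ k _ → zeroˡ _))

  compose-𝟙 : ∀ f → compose 𝟙 f ≈ˢ 𝟙
  compose-𝟙 f = ≈ˢ-by-δ (compose-at-0 𝟙 f) (begin
    δ (compose 𝟙 f)         ≈⟨ δ-compose 𝟙 f ⟩
    δ f ⊛ compose 𝟘 f       ≈⟨ 𝕊.*-congˡ (compose-𝟘 f) ⟩
    δ f ⊛ 𝟘                 ≈⟨ 𝕊.zeroʳ (δ f) ⟩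
    𝟘                       ∎)
    where open ≈ˢ-Reasoning

  compose-⊕ : ∀ a b f → compose (a ⊕ b) f ≈ˢ (compose a f ⊕ compose b f)
  compose-⊕ a b f n = trans (compose-def _ f n) (trans (∑-cong (suc n) (λ k → distribʳ _ _ _))
    (trans (∑-+ (suc n) _ _) (sym (+-cong (compose-def a f n) (compose-def b f n)))))

  -- Both sides satisfy the chain rule; compare coefficients by strong induction.
  compose-⊛ : ∀ a b f → compose (a ⊛ b) f ≈ˢ (compose a f ⊛ compose b f)
  compose-⊛ a b f n = <-rec P step n a b
    where
    P : ℕ → Set _
    P n = ∀ a b → compose (a ⊛ b) f n ≈ (compose a f ⊛ compose b f) n
    step : ∀ n → (∀ {m} → m < n → P m) → P n
    step zero    _  a b = trans (compose-at-0 (a ⊛ b) f) (trans (⊛-at-0 a b)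
      (sym (trans (⊛-at-0 _ _) (*-cong (compose-at-0 a f) (compose-at-0 b f)))))
    step (suc n) IH a b = begin
      compose (a ⊛ b) f (suc n)
        ≈⟨ δ-compose (a ⊛ b) f n ⟩
      (δ f ⊛ compose (δ (a ⊛ b)) f) n
        ≈⟨ 𝕊.*-congˡ (𝕊.trans (compose-congˡ f (δ-⊛ a b)) (compose-⊕ _ _ f)) n ⟩
      (δ f ⊛ (compose (δ a ⊛ b) f ⊕ compose (a ⊛ δ b) f)) n
        ≈⟨ ⊛-cong≤ n (λ _ _ → refl) (λ m m≤n → +-cong (IH (s≤s m≤n) (δ a) b) (IH (s≤s m≤n) a (δ b))) ⟩
      (δ f ⊛ (A′ ⊛ B ⊕ A ⊛ B′)) n
        ≈⟨ 𝕊.distribˡ (δ f) (A′ ⊛ B) (A ⊛ B′) n ⟩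
      (δ f ⊛ (A′ ⊛ B) ⊕ δ f ⊛ (A ⊛ B′)) n
        ≈⟨ 𝕊.+-cong (𝕊.sym (𝕊.*-assoc (δ f) A′ B)) (𝕊.x*yz≈y*xz (δ f) A B′) n ⟩
      ((δ f ⊛ A′) ⊛ B ⊕ A ⊛ (δ f ⊛ B′)) n
        ≈⟨ 𝕊.+-cong (𝕊.*-congʳ (δ-compose a f)) (𝕊.*-congˡ (δ-compose b f)) n ⟨
      (δ A ⊛ B ⊕ A ⊛ δ B) n
        ≈⟨ δ-⊛ A B n ⟨
      (A ⊛ B) (suc n)
        ∎
      where
      open ≈-Reasoning
      A B A′ B′ : Series
      A = compose a f
      B = compose b f
      A′ = compose (δ a) f
      B′ = compose (δ b) f

  compose-assoc : ∀ a g f → compose (compose a g) f ≈ˢ compose a (compose g f)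
  compose-assoc a g f n = <-rec P step n a
    where
    P : ℕ → Set _
    P n = ∀ a → compose (compose a g) f n ≈ compose a (compose g f) n
    step : ∀ n → (∀ {m} → m < n → P m) → P n
    step zero    _  a = trans (compose-at-0 (compose a g) f)
      (trans (compose-at-0 a g) (sym (compose-at-0 a (compose g f))))
    step (suc n) IH a = begin
      compose (compose a g) f (suc n)
        ≈⟨ δ-compose (compose a g) f n ⟩
      (δ f ⊛ compose (δ (compose a g)) f) n
        ≈⟨ 𝕊.*-congˡ (𝕊.trans (compose-congˡ f (δ-compose a g)) (compose-⊛ _ _ f)) n ⟩
      (δ f ⊛ (compose (δ g) f ⊛ compose (compose (δ a) g) f)) n
        ≈⟨ ⊛-cong≤ n (λ _ _ → refl) (λ m m≤n → ⊛-cong≤ m (λ _ _ → refl)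
             (λ i i≤m → IH (s≤s (ℕ.≤-trans i≤m m≤n)) (δ a))) ⟩
      (δ f ⊛ (compose (δ g) f ⊛ compose (δ a) (compose g f))) n
        ≈⟨ 𝕊.*-assoc (δ f) (compose (δ g) f) (compose (δ a) (compose g f)) n ⟨
      ((δ f ⊛ compose (δ g) f) ⊛ compose (δ a) (compose g f)) n
        ≈⟨ 𝕊.*-congʳ (δ-compose g f) n ⟨
      (δ (compose g f) ⊛ compose (δ a) (compose g f)) n
        ≈⟨ δ-compose a (compose g f) n ⟨
      compose a (compose g f) (suc n)
        ∎
      where open ≈-Reasoning

  δt≈𝟙 : δ tSeries ≈ˢ 𝟙
  δt≈𝟙 zero    = refl
  δt≈𝟙 (suc n) = refl

  compose-t : ∀ a → compose a tSeries ≈ˢ a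
  compose-t a zero    = compose-at-0 a tSeries
  compose-t a (suc n) = begin
    compose a tSeries (suc n)                ≈⟨ δ-compose a tSeries n ⟩
    (δ tSeries ⊛ compose (δ a) tSeries) n    ≈⟨ ⊛-cong δt≈𝟙 (λ _ → refl) n ⟩
    (𝟙 ⊛ compose (δ a) tSeries) n            ≈⟨ ⊛-identityˡ _ n ⟩
    compose (δ a) tSeries n                  ≈⟨ compose-t (δ a) n ⟩
    a (suc n)                                ∎
    where open ≈-Reasoning

  t-compose : ∀ h → h 0 ≈ 0# → compose tSeries h ≈ˢ h
  t-compose h h₀ = ≈ˢ-by-δ (trans (compose-at-0 tSeries h) (sym h₀)) (begin
    δ (compose tSeries h)         ≈⟨ δ-compose tSeries h ⟩
    δ h ⊛ compose (δ tSeries) h   ≈⟨ 𝕊.*-congˡ (𝕊.trans (compose-congˡ h δt≈𝟙) (compose-𝟙 h)) ⟩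
    δ h ⊛ 𝟙                       ≈⟨ 𝕊.*-identityʳ (δ h) ⟩
    δ h                           ∎)
    where open ≈ˢ-Reasoning

  compose-cancelʳ : ∀ h {q} → h 1 * q ≈ 1# → ∀ {u v} → compose u h ≈ˢ compose v h → u ≈ˢ v
  compose-cancelʳ h h₁q≈1 {u} {v} e zero    = trans (sym (compose-at-0 u h)) (trans (e 0) (compose-at-0 v h))
  compose-cancelʳ h h₁q≈1 {u} {v} e (suc n) = compose-cancelʳ h h₁q≈1 (⊛-cancelˡ (δ h) h₁q≈1 (begin
      δ h ⊛ compose (δ u) h   ≈⟨ δ-compose u h ⟨
      δ (compose u h)         ≈⟨ (λ n → e (suc n)) ⟩
      δ (compose v h)         ≈⟨ δ-compose v h ⟩
      δ h ⊛ compose (δ v) h   ∎)) n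
    where open ≈ˢ-Reasoning

  compose-bell : ∀ f y n k → compose (bell seriesOps y n k) f ≈ˢ bell seriesOps (λ j → compose (y j) f) n k
  compose-bell f = BellOpsHomomorphism.Multiplicative.bell-homo seriesOps 𝕊.setoid seriesOps
    𝕊.+-cong 𝕊.*-cong (λ a → compose a f) (compose-𝟘 f) (compose-𝟙 f)
    (λ a b → compose-⊕ a b f) (λ a b → compose-⊛ a b f)

  module _ {f h : Series} (h₀ : h 0 ≈ 0#) (f∘h≈t : compose f h ≈ˢ tSeries) where

    h₁f₁≈1 : h 1 * f 1 ≈ 1#
    h₁f₁≈1 = begin
      h 1 * f 1                     ≈⟨ *-congˡ (compose-at-0 (δ f) h) ⟨
      h 1 * compose (δ f) h 0       ≈⟨ ⊛-at-0 (δ h) (compose (δ f) h) ⟨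
      (δ h ⊛ compose (δ f) h) 0     ≈⟨ δ-compose f h 0 ⟨
      compose f h 1                 ≈⟨ f∘h≈t 1 ⟩
      1#                            ∎
      where open ≈-Reasoning

    h∘f≈t : compose h f ≈ˢ tSeries
    h∘f≈t = compose-cancelʳ h h₁f₁≈1 (begin
      compose (compose h f) h       ≈⟨ compose-assoc h f h ⟩
      compose h (compose f h)       ≈⟨ compose-congʳ h f∘h≈t ⟩
      compose h tSeries             ≈⟨ compose-t h ⟩
      h                             ≈⟨ t-compose h h₀ ⟨
      compose tSeries h             ∎)
      where open ≈ˢ-Reasoning

    compose-compose-inverse : ∀ g → compose (compose g h) f ≈ˢ g
    compose-compose-inverse g = 𝕊.trans (compose-assoc g h f) (𝕊.trans (compose-congʳ g h∘f≈t) (compose-t g))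

  ⊛-compose-expand : ∀ b a f {m N} → m < N → (b ⊛ compose a f) m ≈ ∑ N (λ q → a q * (b ⊛ f ^[ q ]) m)
  ⊛-compose-expand b a f {m} {N} m<N = begin
    (b ⊛ compose a f) m
      ≡⟨ ⊛-def b (compose a f) m ⟩
    ∑ (suc m) (λ l → (m C l) × (b l * compose a f (m ∸ l)))
      ≈⟨ ∑-cong< (suc m) (λ l l≤m → ×-congʳ (m C l) (*-congˡ
           (compose-extend a f (ℕ.≤-<-trans (ℕ.m∸n≤m m l) m<N)))) ⟩
    ∑ (suc m) (λ l → (m C l) × (b l * ∑ N (λ q → a q * (f ^[ q ]) (m ∸ l))))
      ≈⟨ ∑-cong (suc m) (λ l → trans (×-congʳ (m C l) (*-distribˡ-∑ N _ _)) (trans (×-∑ (m C l) N _)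
           (∑-cong N (λ q → trans (×-congʳ (m C l) (x*yz≈y*xz _ _ _)) (sym (×-comm-* (m C l) _ _)))))) ⟩
    ∑ (suc m) (λ l → ∑ N (λ q → a q * ((m C l) × (b l * (f ^[ q ]) (m ∸ l)))))
      ≈⟨ ∑-comm (suc m) N _ ⟩
    ∑ N (λ q → ∑ (suc m) (λ l → a q * ((m C l) × (b l * (f ^[ q ]) (m ∸ l)))))
      ≈⟨ ∑-cong N (λ q → trans (sym (*-distribˡ-∑ (suc m) _ _))
           (*-congˡ (reflexive (≡.sym (⊛-def b (f ^[ q ]) m))))) ⟩
    ∑ N (λ q → a q * (b ⊛ f ^[ q ]) m)
      ∎
    where open ≈-Reasoning

  compose-t^[] : ∀ i f → compose t^[ i ] f ≈ˢ (f ^[ i ])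
  compose-t^[] i f n = trans (compose-def t^[ i ] f n) (kronecker (ℕ.<-≤-connex i (suc n)))
    where
    kronecker : i < suc n ⊎ suc n ≤ i → ∑ (suc n) (λ k → t^[ i ] k * (f ^[ k ]) n) ≈ (f ^[ i ]) n
    kronecker (inj₁ i<1+n) = ∑-t^[] i (λ k → (f ^[ k ]) n) i<1+n
    kronecker (inj₂ 1+n≤i) = trans (∑-t^[]-zero i _ 1+n≤i) (sym (^[]-vanish f 1+n≤i))

module FaaDiBruno {c ℓ} (R : CommutativeRing c ℓ) where

  open CommutativeRing R
  open WithRing R using (Series; _≈ˢ_; compose; deriv)
  open ExponentialSeries R
  open Composition R
  private
    module ^[]ˢ = DividedPowers expSeriesRing
    module δ-Bell = BellDerivation.Derivation expSeriesRing δ (λ e m → e (suc m)) (λ _ _ _ → refl) δ-⊛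

  derivBell : Series → ℕ → ℕ → Series
  derivBell f n k = bell seriesOps (λ j → deriv j f) n k

  δ-deriv : ∀ j a → δ (deriv j a) ≈ˢ deriv (suc j) a
  δ-deriv j a m = reflexive (≡.cong a (≡.sym (ℕ.+-suc m j)))

  deriv-1 : ∀ a → deriv 1 a ≈ˢ δ a
  deriv-1 a m = reflexive (≡.cong a (ℕ.+-comm m 1))

  derivBell-suc : ∀ f n k → derivBell f (suc n) (suc k) ≈ˢ (δ (derivBell f n (suc k)) ⊕ δ f ⊛ derivBell f n k)
  derivBell-suc f n k = 𝕊.trans
    (δ-Bell.bell-derivation (λ j → deriv j f) (λ j → δ-deriv j f) n k)
    (𝕊.+-congˡ (𝕊.*-congʳ (deriv-1 f)))

  faa-di-bruno : ∀ g f n → deriv n (compose g f) ≈ˢ 𝕊.∑ (suc n) (λ k → derivBell f n k ⊛ compose (deriv k g) f)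
  faa-di-bruno g f zero = begin
    deriv 0 (compose g f)
      ≈⟨ (λ m → reflexive (≡.cong (compose g f) (ℕ.+-identityʳ m))) ⟩
    compose g f
      ≈⟨ compose-congˡ f (λ m → reflexive (≡.cong g (ℕ.+-identityʳ m))) ⟨
    compose (deriv 0 g) f
      ≈⟨ 𝕊.*-identityˡ _ ⟨
    𝟙 ⊛ compose (deriv 0 g) f
      ≈⟨ 𝕊.+-identityʳ _ ⟨
    𝟙 ⊛ compose (deriv 0 g) f ⊕ 𝟘
      ≡⟨ ≡.trans (𝕊.∑-suc 0 _) (≡.cong (𝟙 ⊛ compose (deriv 0 g) f ⊕_) (𝕊.∑-0 _)) ⟨
    𝕊.∑ 1 (λ k → derivBell f 0 k ⊛ compose (deriv k g) f)
      ∎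
    where open ≈ˢ-Reasoning
  faa-di-bruno g f (suc n) = begin
    deriv (suc n) (compose g f)
      ≈⟨ (λ m → reflexive (≡.cong (compose g f) (ℕ.+-suc m n))) ⟩
    δ (deriv n (compose g f))
      ≈⟨ (λ m → faa-di-bruno g f n (suc m)) ⟩
    δ (𝕊.∑ (suc n) (λ k → γ n k ⊛ G k))
      ≈⟨ δ-∑ (suc n) _ ⟩
    𝕊.∑ (suc n) (λ k → δ (γ n k ⊛ G k))
      ≈⟨ 𝕊.∑-cong (suc n) (λ k → 𝕊.trans (δ-⊛ (γ n k) (G k)) (𝕊.+-congˡ (𝕊.*-congˡ (δ-G k)))) ⟩
    𝕊.∑ (suc n) (λ k → δ (γ n k) ⊛ G k ⊕ γ n k ⊛ (δ f ⊛ G (suc k)))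
      ≈⟨ 𝕊.∑-+ (suc n) _ _ ⟩
    𝕊.∑ (suc n) (λ k → δ (γ n k) ⊛ G k) ⊕ 𝕊.∑ (suc n) (λ k → γ n k ⊛ (δ f ⊛ G (suc k)))
      ≈⟨ 𝕊.+-cong (𝕊.∑-shift n _ first-vanishes last-vanishes)
                  (𝕊.∑-cong (suc n) (λ k → 𝕊.sym (𝕊.*-assoc _ _ _))) ⟩
    𝕊.∑ (suc n) (λ k → δ (γ n (suc k)) ⊛ G (suc k)) ⊕ 𝕊.∑ (suc n) (λ k → γ n k ⊛ δ f ⊛ G (suc k))
      ≈⟨ 𝕊.∑-+ (suc n) _ _ ⟨
    𝕊.∑ (suc n) (λ k → δ (γ n (suc k)) ⊛ G (suc k) ⊕ γ n k ⊛ δ f ⊛ G (suc k))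
      ≈⟨ 𝕊.∑-cong (suc n) (λ k → 𝕊.trans (𝕊.sym (𝕊.distribʳ _ _ _))
           (𝕊.*-congʳ (𝕊.trans (𝕊.+-congˡ (𝕊.*-comm _ _)) (𝕊.sym (derivBell-suc f n k))))) ⟩
    𝕊.∑ (suc n) (λ k → γ (suc n) (suc k) ⊛ G (suc k))
      ≈⟨ 𝕊.+-identityˡ _ ⟨
    𝟘 ⊕ 𝕊.∑ (suc n) (λ k → γ (suc n) (suc k) ⊛ G (suc k))
      ≈⟨ 𝕊.+-congʳ (𝕊.zeroˡ (G 0)) ⟨
    γ (suc n) 0 ⊛ G 0 ⊕ 𝕊.∑ (suc n) (λ k → γ (suc n) (suc k) ⊛ G (suc k))
      ≡⟨ 𝕊.∑-suc (suc n) _ ⟨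
    𝕊.∑ (suc (suc n)) (λ k → γ (suc n) k ⊛ G k)
      ∎
    where
    open ≈ˢ-Reasoning
    γ : ℕ → ℕ → Series
    γ = derivBell f
    G : ℕ → Series
    G k = compose (deriv k g) f
    δ-G : ∀ k → δ (G k) ≈ˢ (δ f ⊛ G (suc k))
    δ-G k = 𝕊.trans (δ-compose (deriv k g) f) (𝕊.*-congˡ (compose-congˡ f (δ-deriv k g)))
    first-vanishes : (δ (γ n 0) ⊛ G 0) ≈ˢ 𝟘
    first-vanishes = 𝕊.trans (𝕊.*-congʳ (δ-Bell.D̂-^[0] (λ j → deriv j f) n)) (𝕊.zeroˡ (G 0))
    last-vanishes : (δ (γ n (suc n)) ⊛ G (suc n)) ≈ˢ 𝟘
    last-vanishes = 𝕊.trans (𝕊.*-congʳ (λ m → ^[]ˢ.^[]-vanish (λ j → deriv j f) (ℕ.n<1+n n) (suc m)))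
      (𝕊.zeroˡ (G (suc n)))

module Operators {c ℓ} (R : CommutativeRing c ℓ) where

  open CommutativeRing R
  open WithRing R
  open Sums R
  open ExponentialSeries R

  coeff-+ᵖ : ∀ p q i → coeff (p +ᵖ q) i ≈ coeff p i + coeff q i
  coeff-+ᵖ []      q       i       = sym (+-identityˡ _)
  coeff-+ᵖ (a ∷ p) []      i       = sym (+-identityʳ _)
  coeff-+ᵖ (a ∷ p) (b ∷ q) zero    = refl
  coeff-+ᵖ (a ∷ p) (b ∷ q) (suc i) = coeff-+ᵖ p q i

  coeff-scaleᵖ : ∀ r p i → coeff (scaleᵖ r p) i ≈ r * coeff p i
  coeff-scaleᵖ r []      i       = sym (zeroʳ r)
  coeff-scaleᵖ r (a ∷ p) zero    = refl
  coeff-scaleᵖ r (a ∷ p) (suc i) = coeff-scaleᵖ r p i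

  coeff-≥length : ∀ p {i} → length p ≤ i → coeff p i ≡ 0#
  coeff-≥length []      _        = ≡.refl
  coeff-≥length (a ∷ p) (s≤s le) = coeff-≥length p le

  length-map-upTo : ∀ (g : ℕ → Carrier) N → length (map g (upTo N)) ≡ N
  length-map-upTo g N = ≡.trans (List.length-map g (upTo N)) (List.length-upTo N)

  coeff-map-upTo-< : ∀ (g : ℕ → Carrier) {N i} → i < N → coeff (map g (upTo N)) i ≡ g i
  coeff-map-upTo-< g {N} i<N = ≡.trans (≡.cong (λ p → coeff p _) (List.map-upTo g N)) (coeff-applyUpTo g i<N)
    where
    coeff-applyUpTo : ∀ (g : ℕ → Carrier) {N i} → i < N → coeff (applyUpTo g N) i ≡ g i
    coeff-applyUpTo g {suc N} {zero}  _         = ≡.refl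
    coeff-applyUpTo g {suc N} {suc i} (s≤s i<N) = coeff-applyUpTo (g ∘ suc) i<N

  coeff-map-upTo-≥ : ∀ (g : ℕ → Carrier) {N i} → N ≤ i → coeff (map g (upTo N)) i ≡ 0#
  coeff-map-upTo-≥ g {N} N≤i = coeff-≥length (map g (upTo N)) (≡.subst (_≤ _) (≡.sym (length-map-upTo g N)) N≤i)

  coeff-monomial : ∀ r i → coeff (monomial r) i ≡ t^[ r ] i
  coeff-monomial zero    zero    = ≡.refl
  coeff-monomial zero    (suc i) = ≡.refl
  coeff-monomial (suc r) zero    = ≡.refl
  coeff-monomial (suc r) (suc i) = coeff-monomial r i

  length-monomial : ∀ r → length (monomial r) ≡ suc r
  length-monomial zero    = ≡.refl
  length-monomial (suc r) = ≡.cong suc (length-monomial r)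

  apply-∑ : ∀ T p {N} → length p ≤ N → ∀ i → coeff (apply T p) i ≈ ∑ N (λ j → coeff p j * coeff (T j) i)
  apply-∑ T []      {N}     _        i = sym (∑-zero N (λ j _ → zeroˡ _))
  apply-∑ T (a ∷ p) {suc N} (s≤s le) i = begin
    coeff (scaleᵖ a (T 0) +ᵖ applyFrom T 1 p) i
      ≈⟨ coeff-+ᵖ (scaleᵖ a (T 0)) (applyFrom T 1 p) i ⟩
    coeff (scaleᵖ a (T 0)) i + coeff (applyFrom T 1 p) i
      ≈⟨ +-cong (coeff-scaleᵖ a (T 0) i) (reflexive (≡.cong (λ q → coeff q i) (applyFrom-suc T 0 p))) ⟩
    a * coeff (T 0) i + coeff (apply (T ∘ suc) p) i
      ≈⟨ +-congˡ (apply-∑ (T ∘ suc) p le i) ⟩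
    a * coeff (T 0) i + ∑ N (λ j → coeff p j * coeff (T (suc j)) i)
      ≡⟨ ∑-suc N _ ⟨
    ∑ (suc N) (λ j → coeff (a ∷ p) j * coeff (T j) i)
      ∎
    where
    open ≈-Reasoning
    applyFrom-suc : ∀ T s p → applyFrom T (suc s) p ≡ applyFrom (T ∘ suc) s p
    applyFrom-suc T s []      = ≡.refl
    applyFrom-suc T s (a ∷ p) = ≡.cong (scaleᵖ a (T (suc s)) +ᵖ_) (applyFrom-suc T (suc s) p)

  apply-monomial : ∀ T r i → coeff (apply T (monomial r)) i ≈ coeff (T r) i
  apply-monomial T r i = begin
    coeff (apply T (monomial r)) i
      ≈⟨ apply-∑ T (monomial r) (ℕ.≤-reflexive (length-monomial r)) i ⟩
    ∑ (suc r) (λ j → coeff (monomial r) j * coeff (T j) i)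
      ≈⟨ ∑-cong (suc r) (λ j → *-congʳ (reflexive (coeff-monomial r j))) ⟩
    ∑ (suc r) (λ j → t^[ r ] j * coeff (T j) i)
      ≈⟨ ∑-t^[] r (λ j → coeff (T j) i) (ℕ.n<1+n r) ⟩
    coeff (T r) i
      ∎
    where open ≈-Reasoning

  apply-mulX : ∀ k p {N} → length p ≤ N →
               ∀ i → coeff (apply (mulX k) p) i ≈ ∑ N (λ j → coeff p j * deriv k t^[ i ] j)
  apply-mulX k p le i = trans (apply-∑ (mulX k) p le i)
    (∑-cong _ (λ j → *-congˡ (reflexive (≡.trans (coeff-monomial (j ℕ.+ k) i) (t^[]-sym (j ℕ.+ k) i)))))

  ≈ᵒ-setoid : Setoid c ℓ
  ≈ᵒ-setoid = record
    { Carrier = Op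
    ; _≈_ = _≈ᵒ_
    ; isEquivalence = record
      { refl = λ _ _ → refl
      ; sym = λ e m i → sym (e m i)
      ; trans = λ e e′ m i → trans (e m i) (e′ m i)
      }
    }

  +ᵒ-cong : ∀ {S S′ T T′} → S ≈ᵒ S′ → T ≈ᵒ T′ → (S +ᵒ T) ≈ᵒ (S′ +ᵒ T′)
  +ᵒ-cong {S} {S′} {T} {T′} eS eT m i = trans (coeff-+ᵖ (S m) (T m) i)
    (trans (+-cong (eS m i) (eT m i)) (sym (coeff-+ᵖ (S′ m) (T′ m) i)))

  ∘ᵒ-cong : ∀ {S S′ T T′} → S ≈ᵒ S′ → T ≈ᵒ T′ → (S ∘ᵒ T) ≈ᵒ (S′ ∘ᵒ T′)
  ∘ᵒ-cong {S} {S′} {T} {T′} eS eT m i = begin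
    coeff (apply S (T m)) i                       ≈⟨ apply-∑ S (T m) (ℕ.m≤m⊔n _ _) i ⟩
    ∑ N (λ j → coeff (T m) j * coeff (S j) i)     ≈⟨ ∑-cong N (λ j → *-cong (eT m j) (eS j i)) ⟩
    ∑ N (λ j → coeff (T′ m) j * coeff (S′ j) i)   ≈⟨ apply-∑ S′ (T′ m) (ℕ.m≤n⊔m _ _) i ⟨
    coeff (apply S′ (T′ m)) i                     ∎
    where
    open ≈-Reasoning
    N : ℕ
    N = length (T m) ℕ.⊔ length (T′ m)

  coeff-sumToᵒ : ∀ n (G : ℕ → Op) m i → coeff (sumTo opOps n G m) i ≈ ∑ (suc n) (λ k → coeff (G k m) i)
  coeff-sumToᵒ n G m i = trans
    (BellOpsHomomorphism.Additive.sumTo-homo opOps setoid ringOps +-cong (λ T → coeff (T m) i) refl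
      (λ S T → coeff-+ᵖ (S m) (T m) i) n G)
    (reflexive (sumTo≡∑ n _))

module ShiftInvariantOperators {c ℓ} (R : CommutativeRing c ℓ) where

  open CommutativeRing R
  open WithRing R
  open Sums R
  open ExponentialSeries R
  open Operators R

  length-seriesOp : ∀ a m → length (seriesOp a m) ≡ suc m
  length-seriesOp a m = length-map-upTo _ (suc m)

  coeff-seriesOp : ∀ a i s → coeff (seriesOp a (i ℕ.+ s)) i ≈ ((i ℕ.+ s) C s) × a s
  coeff-seriesOp a i s = reflexive (≡.trans (coeff-map-upTo-< _ (s≤s (ℕ.m≤m+n i s)))
    (≡.trans (natMul≡× ((i ℕ.+ s) C (i ℕ.+ s ∸ i)) _) (≡.cong (λ t → ((i ℕ.+ s) C t) × a t) (ℕ.m+n∸m≡n i s))))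

  coeff-seriesOp-< : ∀ a {m i} → m < i → coeff (seriesOp a m) i ≈ 0#
  coeff-seriesOp-< a m<i = reflexive (coeff-map-upTo-≥ _ m<i)

  apply-seriesOp : ∀ a p {j N} → length p ≤ j ℕ.+ N →
                   coeff (apply (seriesOp a) p) j ≈ ∑ N (λ q → a q * (((j ℕ.+ q) C q) × coeff p (j ℕ.+ q)))
  apply-seriesOp a p {j} {N} le = begin
    coeff (apply (seriesOp a) p) j
      ≈⟨ apply-∑ (seriesOp a) p le j ⟩
    ∑ (j ℕ.+ N) t
      ≈⟨ ∑-split j N t ⟩
    ∑ j t + ∑ N (λ q → t (j ℕ.+ q))
      ≈⟨ +-congʳ (∑-zero j (λ p′ p′<j → trans (*-congˡ (coeff-seriesOp-< a p′<j)) (zeroʳ _))) ⟩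
    0# + ∑ N (λ q → t (j ℕ.+ q))
      ≈⟨ +-identityˡ _ ⟩
    ∑ N (λ q → coeff p (j ℕ.+ q) * coeff (seriesOp a (j ℕ.+ q)) j)
      ≈⟨ ∑-cong N (λ q → trans (*-cong refl (coeff-seriesOp a j q))
           (trans (*-comm _ _) (trans (×-assoc-* ((j ℕ.+ q) C q) _ _) (sym (×-comm-* ((j ℕ.+ q) C q) _ _))))) ⟩
    ∑ N (λ q → a q * (((j ℕ.+ q) C q) × coeff p (j ℕ.+ q)))
      ∎
    where
    open ≈-Reasoning
    t : ℕ → Carrier
    t p′ = coeff p p′ * coeff (seriesOp a p′) j

  seriesOp-𝟘 : seriesOp 𝟘 ≈ᵒ (λ _ → [])
  seriesOp-𝟘 m i with offset i m
  ... | i+ s   = trans (coeff-seriesOp 𝟘 i s) (×-zeroʳ ((i ℕ.+ s) C s))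
  ... | <i m<i = coeff-seriesOp-< 𝟘 m<i

  seriesOp-𝟙 : seriesOp 𝟙 ≈ᵒ idOp
  seriesOp-𝟙 m i with offset i m
  ... | <i m<i = trans (coeff-seriesOp-< 𝟙 m<i) (reflexive (≡.sym (≡.trans (coeff-monomial m i) (t^[]-above m<i))))
  ... | i+ s   = trans (coeff-seriesOp 𝟙 i s)
    (trans (diagonal s) (reflexive (≡.sym (≡.trans (coeff-monomial (i ℕ.+ s) i) (t^[+]-at i s)))))
    where
    diagonal : ∀ s → ((i ℕ.+ s) C s) × 𝟙 s ≈ 𝟙 s
    diagonal zero    = ×-homo-1 1#
    diagonal (suc s) = ×-zeroʳ ((i ℕ.+ suc s) C suc s)

  seriesOp-⊕ : ∀ a b → seriesOp (a ⊕ b) ≈ᵒ (seriesOp a +ᵒ seriesOp b)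
  seriesOp-⊕ a b m i with offset i m
  ... | i+ s   = trans (coeff-seriesOp (a ⊕ b) i s) (trans (×-distrib-+ (a s) (b s) ((i ℕ.+ s) C s))
    (sym (trans (coeff-+ᵖ (seriesOp a (i ℕ.+ s)) (seriesOp b (i ℕ.+ s)) i)
      (+-cong (coeff-seriesOp a i s) (coeff-seriesOp b i s)))))
  ... | <i m<i = trans (coeff-seriesOp-< (a ⊕ b) m<i) (sym (trans (coeff-+ᵖ (seriesOp a m) (seriesOp b m) i)
    (trans (+-cong (coeff-seriesOp-< a m<i) (coeff-seriesOp-< b m<i)) (+-identityʳ 0#))))

  seriesOp-⊛ : ∀ a b → seriesOp (a ⊛ b) ≈ᵒ (seriesOp a ∘ᵒ seriesOp b)
  seriesOp-⊛ a b m i with offset i m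
  ... | <i m<i = trans (coeff-seriesOp-< (a ⊛ b) m<i)
    (sym (trans (apply-seriesOp a (seriesOp b m) length≤) (reflexive (∑-0 _))))
    where
    length≤ : length (seriesOp b m) ≤ i ℕ.+ 0
    length≤ = ℕ.≤-trans (ℕ.≤-reflexive (length-seriesOp b m)) (ℕ.≤-trans m<i (ℕ.m≤m+n i 0))
  ... | i+ s = begin
    coeff (seriesOp (a ⊛ b) (i ℕ.+ s)) i
      ≈⟨ coeff-seriesOp (a ⊛ b) i s ⟩
    ((i ℕ.+ s) C s) × (a ⊛ b) s
      ≈⟨ ×-congʳ ((i ℕ.+ s) C s) (reflexive (⊛-def a b s)) ⟩
    ((i ℕ.+ s) C s) × ∑ (suc s) (λ q → (s C q) × (a q * b (s ∸ q)))
      ≈⟨ ×-∑ ((i ℕ.+ s) C s) (suc s) _ ⟩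
    ∑ (suc s) (λ q → ((i ℕ.+ s) C s) × ((s C q) × (a q * b (s ∸ q))))
      ≈⟨ ∑-cong< (suc s) (λ q q<1+s → sym (term′ q (ℕ.s≤s⁻¹ q<1+s))) ⟩
    ∑ (suc s) (λ q → a q * (((i ℕ.+ q) C q) × coeff (seriesOp b (i ℕ.+ s)) (i ℕ.+ q)))
      ≈⟨ apply-seriesOp a (seriesOp b (i ℕ.+ s)) length≤ ⟨
    coeff (apply (seriesOp a) (seriesOp b (i ℕ.+ s))) i
      ∎
    where
    open ≈-Reasoning
    open BinomialCoefficients using ([i+q]Cq*[i+q+r]Cr≡[i+q+r]C[q+r]*[q+r]Cq)
    length≤ : length (seriesOp b (i ℕ.+ s)) ≤ i ℕ.+ suc s
    length≤ = ℕ.≤-reflexive (≡.trans (length-seriesOp b (i ℕ.+ s)) (≡.sym (ℕ.+-suc i s)))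
    term : ∀ q r → a q * (((i ℕ.+ q) C q) × coeff (seriesOp b (i ℕ.+ (q ℕ.+ r))) (i ℕ.+ q))
                 ≈ ((i ℕ.+ (q ℕ.+ r)) C (q ℕ.+ r)) × (((q ℕ.+ r) C q) × (a q * b (q ℕ.+ r ∸ q)))
    term q r = begin
      a q * (((i ℕ.+ q) C q) × coeff (seriesOp b (i ℕ.+ (q ℕ.+ r))) (i ℕ.+ q))
        ≡⟨ ≡.cong (λ t → a q * (((i ℕ.+ q) C q) × coeff (seriesOp b t) (i ℕ.+ q))) (ℕ.+-assoc i q r) ⟨
      a q * (((i ℕ.+ q) C q) × coeff (seriesOp b (i ℕ.+ q ℕ.+ r)) (i ℕ.+ q))
        ≈⟨ *-congˡ (×-congʳ ((i ℕ.+ q) C q) (coeff-seriesOp b (i ℕ.+ q) r)) ⟩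
      a q * (((i ℕ.+ q) C q) × (((i ℕ.+ q ℕ.+ r) C r) × b r))
        ≈⟨ trans (×-comm-* ((i ℕ.+ q) C q) (a q) _)
             (×-congʳ ((i ℕ.+ q) C q) (×-comm-* ((i ℕ.+ q ℕ.+ r) C r) (a q) (b r))) ⟩
      ((i ℕ.+ q) C q) × (((i ℕ.+ q ℕ.+ r) C r) × (a q * b r))
        ≈⟨ ×-assocˡ (a q * b r) ((i ℕ.+ q) C q) ((i ℕ.+ q ℕ.+ r) C r) ⟩
      (((i ℕ.+ q) C q) ℕ.* ((i ℕ.+ q ℕ.+ r) C r)) × (a q * b r)
        ≡⟨ ≡.cong (_× (a q * b r)) ([i+q]Cq*[i+q+r]Cr≡[i+q+r]C[q+r]*[q+r]Cq i q r) ⟩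
      (((i ℕ.+ (q ℕ.+ r)) C (q ℕ.+ r)) ℕ.* ((q ℕ.+ r) C q)) × (a q * b r)
        ≈⟨ ×-assocˡ (a q * b r) ((i ℕ.+ (q ℕ.+ r)) C (q ℕ.+ r)) ((q ℕ.+ r) C q) ⟨
      ((i ℕ.+ (q ℕ.+ r)) C (q ℕ.+ r)) × (((q ℕ.+ r) C q) × (a q * b r))
        ≡⟨ ≡.cong (λ t → ((i ℕ.+ (q ℕ.+ r)) C (q ℕ.+ r)) × (((q ℕ.+ r) C q) × (a q * b t))) (ℕ.m+n∸m≡n q r) ⟨
      ((i ℕ.+ (q ℕ.+ r)) C (q ℕ.+ r)) × (((q ℕ.+ r) C q) × (a q * b (q ℕ.+ r ∸ q)))
        ∎
    term′ : ∀ q {s} → q ≤ s → a q * (((i ℕ.+ q) C q) × coeff (seriesOp b (i ℕ.+ s)) (i ℕ.+ q))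
                            ≈ ((i ℕ.+ s) C s) × ((s C q) × (a q * b (s ∸ q)))
    term′ q q≤s with ℕ.m≤n⇒∃[o]m+o≡n q≤s
    ... | r , ≡.refl = term q r

  seriesOp-bell : ∀ y n k → seriesOp (bell seriesOps y n k) ≈ᵒ bell opOps (seriesOp ∘ y) n k
  seriesOp-bell = BellOpsHomomorphism.Multiplicative.bell-homo seriesOps ≈ᵒ-setoid opOps
    (λ {S} {S′} {T} {T′} → +ᵒ-cong {S} {S′} {T} {T′}) (λ {S} {S′} {T} {T′} → ∘ᵒ-cong {S} {S′} {T} {T′})
    seriesOp seriesOp-𝟘 seriesOp-𝟙 seriesOp-⊕ seriesOp-⊛

module UmbralCalculus {c ℓ} (R : CommutativeRing c ℓ) where

  open CommutativeRing R
  open WithRing R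
  open Sums R
  open ExponentialSeries R
  open DividedPowers R
  open Composition R
  open FaaDiBruno R
  open Operators R
  open ShiftInvariantOperators R

  length-umbral : ∀ f m → length (umbral f m) ≡ suc m
  length-umbral f m = length-map-upTo _ (suc m)

  coeff-umbral : ∀ f m i → coeff (umbral f m) i ≈ (f ^[ i ]) m
  coeff-umbral f m i with offset i m
  ... | i+ s   = reflexive (coeff-map-upTo-< _ (s≤s (ℕ.m≤m+n i s)))
  ... | <i m<i = trans (reflexive (coeff-map-upTo-≥ _ m<i)) (sym (^[]-vanish f m<i))

  coeff-seriesOp-umbral : ∀ a f m j → coeff ((seriesOp a ∘ᵒ umbral f) m) j ≈ (f ^[ j ] ⊛ compose a f) m
  coeff-seriesOp-umbral a f m j = begin
    coeff (apply (seriesOp a) (umbral f m)) j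
      ≈⟨ apply-seriesOp a (umbral f m) (ℕ.≤-trans (ℕ.≤-reflexive (length-umbral f m)) (ℕ.m≤n+m (suc m) j)) ⟩
    ∑ (suc m) (λ q → a q * (((j ℕ.+ q) C q) × coeff (umbral f m) (j ℕ.+ q)))
      ≈⟨ ∑-cong (suc m) (λ q → *-congˡ
           (trans (×-congʳ ((j ℕ.+ q) C q) (coeff-umbral f m (j ℕ.+ q))) (sym (binomial q)))) ⟩
    ∑ (suc m) (λ q → a q * (f ^[ j ] ⊛ f ^[ q ]) m)
      ≈⟨ ⊛-compose-expand (f ^[ j ]) a f (ℕ.n<1+n m) ⟨
    (f ^[ j ] ⊛ compose a f) m
      ∎
    where
    open ≈-Reasoning
    binomial : ∀ q → (f ^[ j ] ⊛ f ^[ q ]) m ≈ ((j ℕ.+ q) C q) × (f ^[ j ℕ.+ q ]) m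
    binomial q = trans (⊛-comm (f ^[ j ]) (f ^[ q ]) m) (trans (^[]-⊛-^[] f q j m)
      (trans (×ˢ-at ((q ℕ.+ j) C q) (f ^[ q ℕ.+ j ]) m)
        (reflexive (≡.cong (λ t → (t C q) × (f ^[ t ]) m) (ℕ.+-comm q j)))))

  coeff-mulX-seriesOp-umbral : ∀ k a f m i →
    coeff ((mulX k ∘ᵒ (seriesOp a ∘ᵒ umbral f)) m) i ≈ (compose a f ⊛ compose (deriv k t^[ i ]) f) m
  coeff-mulX-seriesOp-umbral k a f m i = begin
    coeff (apply (mulX k) P) i
      ≈⟨ apply-mulX k P (ℕ.m≤m⊔n _ _) i ⟩
    ∑ N (λ j → coeff P j * A j)
      ≈⟨ ∑-cong N (λ j → trans (*-congʳ (coeff-seriesOp-umbral a f m j))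
           (trans (*-comm _ _) (*-congˡ (⊛-comm (f ^[ j ]) (compose a f) m)))) ⟩
    ∑ N (λ j → A j * (compose a f ⊛ f ^[ j ]) m)
      ≈⟨ ⊛-compose-expand (compose a f) A f (ℕ.m≤n⊔m (length P) (suc m)) ⟨
    (compose a f ⊛ compose A f) m
      ∎
    where
    open ≈-Reasoning
    P : Poly
    P = (seriesOp a ∘ᵒ umbral f) m
    A : Series
    A = deriv k t^[ i ]
    N : ℕ
    N = length P ℕ.⊔ suc m

  coeff-umbral-mulX : ∀ f n m i → coeff ((umbral f ∘ᵒ mulX n) m) i ≈ deriv n (f ^[ i ]) m
  coeff-umbral-mulX f n m i = trans (apply-monomial (umbral f) (m ℕ.+ n) i) (coeff-umbral f (m ℕ.+ n) i)

  module _ {f h : Series} (h₀ : h 0 ≈ 0#) (f∘h≈t : compose f h ≈ˢ tSeries) where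

    bell-atQ : ∀ n k → bell opOps (λ j → atQ h (deriv j f)) n k
                         ≈ᵒ seriesOp (bell seriesOps (λ j → compose (deriv j f) h) n k)
    bell-atQ n k m i = sym (seriesOp-bell (λ j → compose (deriv j f) h) n k m i)

    compose-bell-atQ : ∀ n k → compose (bell seriesOps (λ j → compose (deriv j f) h) n k) f ≈ˢ derivBell f n k
    compose-bell-atQ n k = 𝕊.trans (compose-bell f _ n k)
      (CongruentBellOps.bell-cong 𝕊.setoid seriesOps 𝕊.+-cong 𝕊.*-cong
        (λ j → compose-compose-inverse h₀ f∘h≈t (deriv j f)) n k)

    coeff-mulX-bell-atQ-umbral : ∀ n k m i →
      coeff ((mulX k ∘ᵒ (bell opOps (λ j → atQ h (deriv j f)) n k ∘ᵒ umbral f)) m) i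
        ≈ (derivBell f n k ⊛ compose (deriv k t^[ i ]) f) m
    coeff-mulX-bell-atQ-umbral n k m i = trans
      (∘ᵒ-cong {mulX k} {mulX k} {B ∘ᵒ umbral f} {seriesOp X ∘ᵒ umbral f} (λ _ _ → refl)
        (∘ᵒ-cong {B} {seriesOp X} {umbral f} {umbral f} (bell-atQ n k) (λ _ _ → refl)) m i)
      (trans (coeff-mulX-seriesOp-umbral k X f m i) (⊛-cong (compose-bell-atQ n k) (λ _ → refl) m))
      where
      B : Op
      B = bell opOps (λ j → atQ h (deriv j f)) n k
      X : Series
      X = bell seriesOps (λ j → compose (deriv j f) h) n k

theorem1 : ∀ {c ℓ : Level} (R : CommutativeRing c ℓ) →
    let open CommutativeRing R
        open WithRing R
    in IsFieldChar0 →
       (f : Series) → f 0 ≈ 0# → ¬ (f 1 ≈ 0#) →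
       (h : Series) → h 0 ≈ 0# → compose f h ≈ˢ tSeries →
       (n : ℕ) →
       (umbral f ∘ᵒ mulX n)
         ≈ᵒ sumTo opOps n (λ k →
              mulX k ∘ᵒ (bell opOps (λ j → atQ h (deriv j f)) n k ∘ᵒ umbral f))
theorem1 R _ f _ _ h h₀ f∘h≈t n m i = begin
  coeff ((umbral f ∘ᵒ mulX n) m) i
    ≈⟨ coeff-umbral-mulX f n m i ⟩
  deriv n (f ^[ i ]) m
    ≈⟨ compose-t^[] i f (m ℕ.+ n) ⟨
  deriv n (compose t^[ i ] f) m
    ≈⟨ trans (faa-di-bruno t^[ i ] f n m) (∑ˢ-at (suc n) _ m) ⟩
  ∑ (suc n) (λ k → (derivBell f n k ⊛ compose (deriv k t^[ i ]) f) m)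
    ≈⟨ ∑-cong (suc n) (λ k → coeff-mulX-bell-atQ-umbral h₀ f∘h≈t n k m i) ⟨
  ∑ (suc n) (λ k → coeff ((mulX k ∘ᵒ (B k ∘ᵒ umbral f)) m) i)
    ≈⟨ coeff-sumToᵒ n (λ k → mulX k ∘ᵒ (B k ∘ᵒ umbral f)) m i ⟨
  coeff (sumTo opOps n (λ k → mulX k ∘ᵒ (B k ∘ᵒ umbral f)) m) i
    ∎
  where
  open CommutativeRing R
  open WithRing R
  open Sums R
  open ExponentialSeries R
  open DividedPowers R
  open Composition R
  open FaaDiBruno R
  open Operators R
  open ShiftInvariantOperators R
  open UmbralCalculus R
  open ≈-Reasoning
  B : ℕ → Op
  B k = bell opOps (λ j → atQ h (deriv j f)) n k
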